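{- Let $\mathcal{C}$ be either $\{\sigma:\mathbf{S}(\mathbf{S}(\sigma))=\mathrm{id}\}$ or $\{\sigma:\mathbf{S}(\mathbf{r}(\mathbf{S}(\sigma)))=\mathrm{id}\}$. Then for every $\pi\in\mathcal{C}$ of size $n\ge 2$, the permutation obtained by deleting the last letter of $\pi$ and normalizing lies in $\mathcal{C}$; the permutation $1$ has label $(2,1,(1))$; and for every $\pi\in\mathcal{C}$ with label $(x,k,(p_1,\dots,p_k))$, the multiset of labels of its children is exactly $\{(2+p_j,\,j,\,(p_1,\dots,p_{j-1},i)) : 1\le j\le k,\ p_{j-1}<i\le p_j\}\ \cup\ \{(x+1,\,k+1,\,(p_1,\dots,p_k,i)) : p_k<i\le x\}$, with the convention $p_0=0$.
   Context: The stack sorting operator: $\mathbf{S}(\varepsilon)=\varepsilon$, $\mathbf{S}(LmR)=\mathbf{S}(L)\mathbf{S}(R)m$ with $m$ the maximum letter of $LmR$; $\mathbf{r}$ is reversal of a word; $\mathrm{id}=12\cdots n$. For $\pi\in\mathcal{C}$ of size $n$ and $t\in\{0,1,\dots,n\}$ (the "site" at height between values $t$ and $t+1$, to the right of $\pi$), let $\pi^{(t)}$ be the permutation of size $n+1$ with last letter $t+1$ whose first $n$ letters are $\pi$ with every value $\ge t+1$ increased by $1$ (insertion rule "Rightmost"). The site $t$ is active if $\pi^{(t)}\in\mathcal{C}$; the children of $\pi$ are the $\pi^{(t)}$ for active sites $t$. A site $t$ is above a value $v$ if $t\ge v$. The label of $\pi$ is $(x,k,(p_1,\dots,p_k))$ where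 $x$ is the number of active sites of $\pi$, $k$ is the number of right-to-left maxima of $\pi$ (entries larger than all entries to their right), and, listing the values of the right-to-left maxima in decreasing order $v_1>v_2>\dots>v_k$, $p_\ell$ is the number of active sites above $v_\ell$. -}

module Defs where

open import Data.Nat using (ℕ; zero; suc; _+_; _∸_; _⊔_; _≡ᵇ_; _<ᵇ_; _≤ᵇ_)
open import Data.Bool using (Bool; true; false; _∧_; not; if_then_else_; T)
open import Data.List using (List; []; _∷_; _++_; [_]; map; length; upTo; filterᵇ; take; concatMap; foldr)
open import Data.Product using (_×_; _,_)
open import Relation.Binary.PropositionalEquality using (_≡_)

-- Permutations are words (lists) over ℕ; a permutation of size n is a word
-- of length n whose letters are exactly 1,…,n (in range and pairwise distinct).

allᵇ : (ℕ → Bool) → List ℕ → Bool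
allᵇ p []       = true
allᵇ p (x ∷ xs) = p x ∧ allᵇ p xs

anyᵇ : (ℕ → Bool) → List ℕ → Bool
anyᵇ p []       = false
anyᵇ p (x ∷ xs) = if p x then true else anyᵇ p xs

distinctᵇ : List ℕ → Bool
distinctᵇ []       = true
distinctᵇ (x ∷ xs) = not (anyᵇ (x ≡ᵇ_) xs) ∧ distinctᵇ xs

isPermᵇ : List ℕ → Bool
isPermᵇ w = allᵇ (λ a → (1 ≤ᵇ a) ∧ (a ≤ᵇ length w)) w ∧ distinctᵇ w

idPerm : ℕ → List ℕ
idPerm n = map suc (upTo n)

maxL : List ℕ → ℕ
maxL = foldr _⊔_ 0

-- Stack sorting S(ε)=ε, S(LmR)=S(L)S(R)m, m the maximum letter.
-- The first argument is fuel; L and R are strictly shorter than LmR,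
-- so fuel = length of the word suffices (see stackSort).
splitAtMax : ℕ → List ℕ → List ℕ × List ℕ
splitAtMax m []       = [] , []
splitAtMax m (x ∷ xs) with m ≡ᵇ x
... | true  = [] , xs
... | false with splitAtMax m xs
...   | L , R = x ∷ L , R

S′ : ℕ → List ℕ → List ℕ
S′ zero    w        = []
S′ (suc f) []       = []
S′ (suc f) (x ∷ xs) with splitAtMax (maxL (x ∷ xs)) (x ∷ xs)
... | L , R = S′ f L ++ S′ f R ++ [ maxL (x ∷ xs) ]

stackSort : List ℕ → List ℕ
stackSort w = S′ (length w) w

rev : List ℕ → List ℕ
rev []       = []
rev (x ∷ xs) = rev xs ++ [ x ]

eqᵇ : List ℕ → List ℕ → Bool
eqᵇ []       []       = true
eqᵇ []       (_ ∷ _)  = false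
eqᵇ (_ ∷ _)  []       = false
eqᵇ (x ∷ xs) (y ∷ ys) = (x ≡ᵇ y) ∧ eqᵇ xs ys

data Class : Set where
  SS SrS : Class

inCᵇ : Class → List ℕ → Bool
inCᵇ SS  σ = isPermᵇ σ ∧ eqᵇ (stackSort (stackSort σ)) (idPerm (length σ))
inCᵇ SrS σ = isPermᵇ σ ∧ eqᵇ (stackSort (rev (stackSort σ))) (idPerm (length σ))

InC : Class → List ℕ → Set
InC c σ = T (inCᵇ c σ)

-- π^(t): values ≥ t+1 increased by 1, then append t+1 (rule "Rightmost")
insertAt : List ℕ → ℕ → List ℕ
insertAt π t = map (λ a → if t <ᵇ a then suc a else a) π ++ [ suc t ]

initL : List ℕ → List ℕ
initL []           = []
initL (x ∷ [])     = []
initL (x ∷ y ∷ ys) = x ∷ initL (y ∷ ys)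

lastL : List ℕ → ℕ
lastL []           = 0
lastL (x ∷ [])     = x
lastL (x ∷ y ∷ ys) = lastL (y ∷ ys)

deleteLast : List ℕ → List ℕ
deleteLast π = map (λ a → if lastL π <ᵇ a then a ∸ 1 else a) (initL π)

activeSites : Class → List ℕ → List ℕ
activeSites c π = filterᵇ (λ t → inCᵇ c (insertAt π t)) (upTo (suc (length π)))

-- values of right-to-left maxima, in left-to-right order (= decreasing)
rlMaxima : List ℕ → List ℕ
rlMaxima []       = []
rlMaxima (a ∷ w)  = if allᵇ (_<ᵇ a) w then a ∷ rlMaxima w else rlMaxima w

Label : Set
Label = ℕ × ℕ × List ℕ

label : Class → List ℕ → Label
label c π =
  length (activeSites c π) ,
  length (rlMaxima π) ,
  map (λ v → length (filterᵇ (λ t → v ≤ᵇ t) (activeSites c π))) (rlMaxima π)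

childLabels : Class → List ℕ → List Label
childLabels c π = map (λ t → label c (insertAt π t)) (activeSites c π)

-- {i : a < i ≤ b}
range : ℕ → ℕ → List ℕ
range a b = map (λ d → a + suc d) (upTo (b ∸ a))

-- p_j with convention p_0 = 0 (1-indexed)
pAt : List ℕ → ℕ → ℕ
pAt ps       zero          = 0
pAt []       (suc j)       = 0
pAt (p ∷ ps) (suc zero)    = p
pAt (p ∷ ps) (suc (suc j)) = pAt ps (suc j)

expectedChildren : Label → List Label
expectedChildren (x , k , ps) =
  concatMap (λ j → map (λ i → (2 + pAt ps j , j , take (j ∸ 1) ps ++ [ i ]))
                       (range (pAt ps (j ∸ 1)) (pAt ps j)))
            (map suc (upTo k))
  ++ map (λ i → (suc x , suc k , ps ++ [ i ])) (range (pAt ps k) x)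

module Submission where

open import Defs
open import Data.Nat using (ℕ; zero; suc; _+_; _∸_; _≡ᵇ_; _<ᵇ_; _≤ᵇ_; _≤_; _<_; z≤n; s≤s; z<s)
open import Data.Nat.Properties
open import Data.Bool using (Bool; true; false; _∧_; not; if_then_else_; T)
open import Data.List using (List; []; _∷_; _++_; [_]; map; length; upTo; filterᵇ; take; concatMap; reverse; applyUpTo; drop)
open import Data.List.Properties
open import Data.List.Relation.Unary.All using (All; []; _∷_)
import Data.List.Relation.Unary.All.Properties as AllP
import Data.List.Relation.Unary.All as AllM
open import Data.List.Relation.Unary.Any using (Any; here; there)
open import Data.List.Membership.Propositional using (_∈_)
open import Data.List.Membership.Propositional.Properties using (∈-map⁺; ∈-upTo⁺)
open import Data.Product using (_×_; _,_; proj₁; proj₂; ∃)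
open import Data.Sum using (_⊎_; inj₁; inj₂)
open import Data.Empty using (⊥; ⊥-elim)
open import Data.Unit using (⊤; tt)
open import Relation.Nullary using (¬_; yes; no)
open import Relation.Binary.Definitions using (tri<; tri≈; tri>)
open import Relation.Binary.PropositionalEquality hiding ([_])
open import Data.List.Relation.Binary.Permutation.Propositional using (_↭_; ↭-refl; ↭-reflexive; ↭-sym; ↭-trans; module PermutationReasoning)
import Data.List.Relation.Binary.Permutation.Propositional as ↭
import Data.List.Relation.Binary.Permutation.Propositional.Properties as PermP
import Data.List.Relation.Unary.Any.Properties as AnyP
import Data.List.Relation.Unary.Any as AnyM

-- S is modelled as a stack machine.  By Knuth's theorem S(w) is sorted iff w
-- avoids 231, so σ ∈ SS (resp. SrS) iff σ is a permutation and S(σ) avoids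
-- 231 (resp. 132).  Write S(π) = E ++ F with F the final stack of the machine,
-- i.e. the right-to-left maxima read upwards.  Appending t+1 gives
-- S(π^(t)) = bump(E) ++ lowPart ++ (t+1) ∷ highPart, where lowPart, highPart
-- are the maxima below, above t+1; hence t is an active site iff no pair of E
-- forms the forbidden pattern together with t+1.  This criterion gives closure
-- under deleting the last letter, and it describes the active sites of a
-- child: those of π above t (shifted by one), those below the maxima popped by
-- t+1, and exactly one site below the largest popped maximum.  Counting active
-- sites gives the label of each child; grouping the active sites between
-- consecutive right-to-left maxima gives the list `expectedChildren`.

T⇒true : ∀ {a} → T a → a ≡ true
T⇒true {true} _ = refl

¬T⇒false : ∀ {a} → ¬ T a → a ≡ false
¬T⇒false {false} _ = refl
¬T⇒false {true} n = ⊥-elim (n tt)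

T-ext : ∀ {a b} → (T a → T b) → (T b → T a) → a ≡ b
T-ext {false} {false} _ _ = refl
T-ext {false} {true} _ g = ⊥-elim (g tt)
T-ext {true} {false} f _ = ⊥-elim (f tt)
T-ext {true} {true} _ _ = refl

<ᵇ-true : ∀ {a b} → a < b → (a <ᵇ b) ≡ true
<ᵇ-true a<b = T⇒true (<⇒<ᵇ a<b)

<ᵇ-false : ∀ {a b} → b ≤ a → (a <ᵇ b) ≡ false
<ᵇ-false {a} {b} b≤a = ¬T⇒false (λ t → <⇒≱ (<ᵇ⇒< a b t) b≤a)

<ᵇ-true⁻ : ∀ {a b} → (a <ᵇ b) ≡ true → a < b
<ᵇ-true⁻ {a} {b} e = <ᵇ⇒< a b (subst T (sym e) tt)

<ᵇ-false⁻ : ∀ {a b} → (a <ᵇ b) ≡ false → b ≤ a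
<ᵇ-false⁻ e = ≮⇒≥ (λ a<b → subst T e (<⇒<ᵇ a<b))

≡ᵇ-true⁻ : ∀ {a b} → (a ≡ᵇ b) ≡ true → a ≡ b
≡ᵇ-true⁻ {a} {b} e = ≡ᵇ⇒≡ a b (subst T (sym e) tt)

≡ᵇ-false⁻ : ∀ {a b} → (a ≡ᵇ b) ≡ false → a ≢ b
≡ᵇ-false⁻ {a} {b} e a≡b = subst T e (≡⇒≡ᵇ a b a≡b)

≤ᵇ-true : ∀ {v m} → v ≤ m → (v ≤ᵇ m) ≡ true
≤ᵇ-true v≤m = T⇒true (≤⇒≤ᵇ v≤m)

≤ᵇ-false : ∀ {v m} → m < v → (v ≤ᵇ m) ≡ false
≤ᵇ-false {v} {m} m<v = ¬T⇒false (λ t → <⇒≱ m<v (≤ᵇ⇒≤ v m t))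

T-∧⁻ : ∀ {a b} → T (a ∧ b) → T a × T b
T-∧⁻ {true} {true} _ = tt , tt

T-∧⁺ : ∀ {a b} → T a → T b → T (a ∧ b)
T-∧⁺ {true} {true} _ _ = tt

T-not⁻ : ∀ {b} → T (not b) → b ≡ false
T-not⁻ {false} _ = refl

T-not⁺ : ∀ {b} → b ≡ false → T (not b)
T-not⁺ refl = tt

allᵇ-sound : ∀ p w → T (allᵇ p w) → All (λ x → T (p x)) w
allᵇ-sound p [] _ = []
allᵇ-sound p (x ∷ w) t = proj₁ (T-∧⁻ {p x} t) ∷ allᵇ-sound p w (proj₂ (T-∧⁻ {p x} t))

allᵇ-complete : ∀ p w → All (λ x → T (p x)) w → T (allᵇ p w)
allᵇ-complete p [] _ = tt
allᵇ-complete p (x ∷ w) (a ∷ as) = T-∧⁺ {p x} a (allᵇ-complete p w as)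

allᵇ-++ : ∀ p u v → allᵇ p (u ++ v) ≡ (allᵇ p u ∧ allᵇ p v)
allᵇ-++ p [] v = refl
allᵇ-++ p (x ∷ u) v with p x
... | true = allᵇ-++ p u v
... | false = refl

anyᵇ-false-sound : ∀ x w → anyᵇ (x ≡ᵇ_) w ≡ false → All (x ≢_) w
anyᵇ-false-sound x [] _ = []
anyᵇ-false-sound x (y ∷ w) e with x ≡ᵇ y in x≡ᵇy
... | true = ⊥-elim (subst T e tt)
... | false = ≡ᵇ-false⁻ x≡ᵇy ∷ anyᵇ-false-sound x w e

anyᵇ-false-complete : ∀ x w → All (x ≢_) w → anyᵇ (x ≡ᵇ_) w ≡ false
anyᵇ-false-complete x [] _ = refl
anyᵇ-false-complete x (y ∷ w) (x≢y ∷ x∉w) with x ≡ᵇ y in x≡ᵇy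
... | true = ⊥-elim (x≢y (≡ᵇ-true⁻ x≡ᵇy))
... | false = anyᵇ-false-complete x w x∉w

eqᵇ-sound : ∀ u v → T (eqᵇ u v) → u ≡ v
eqᵇ-sound [] [] _ = refl
eqᵇ-sound (x ∷ u) (y ∷ v) t with T-∧⁻ {x ≡ᵇ y} t
... | x≡y , u≡v = cong₂ _∷_ (≡ᵇ⇒≡ x y x≡y) (eqᵇ-sound u v u≡v)

eqᵇ-refl : ∀ u → T (eqᵇ u u)
eqᵇ-refl [] = tt
eqᵇ-refl (x ∷ u) = T-∧⁺ {x ≡ᵇ x} (≡⇒≡ᵇ x x refl) (eqᵇ-refl u)

All-Any : ∀ {P Q : ℕ → Set} {w} → All P w → Any Q w → ∃ λ x → P x × Q x
All-Any (p ∷ _) (here q) = _ , p , q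
All-Any (_ ∷ ps) (there a) = All-Any ps a

All-reverse : ∀ {P : ℕ → Set} w → All P w → All P (reverse w)
All-reverse w a = PermP.All-resp-↭ (↭-sym (PermP.↭-reverse w)) a

snoc-induction : (P : List ℕ → Set) → P [] → (∀ w a → P w → P (w ++ a ∷ [])) → ∀ w → P w
snoc-induction P p0 ps w = subst P (reverse-involutive w) (go (reverse w))
  where
    go : ∀ xs → P (reverse xs)
    go [] = p0
    go (x ∷ xs) = subst P (sym (unfold-reverse x xs)) (ps (reverse xs) x (go xs))

applyUpTo-cong : ∀ (f g : ℕ → ℕ) n → (∀ x → f x ≡ g x) → applyUpTo f n ≡ applyUpTo g n
applyUpTo-cong f g zero _ = refl
applyUpTo-cong f g (suc n) e = cong₂ _∷_ (e 0) (applyUpTo-cong (λ x → f (suc x)) (λ x → g (suc x)) n (λ x → e (suc x)))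

rev≡reverse : ∀ w → rev w ≡ reverse w
rev≡reverse [] = refl
rev≡reverse (x ∷ w) = trans (cong (_++ x ∷ []) (rev≡reverse w)) (sym (unfold-reverse x w))

initL++lastL : ∀ x xs → x ∷ xs ≡ initL (x ∷ xs) ++ lastL (x ∷ xs) ∷ []
initL++lastL x [] = refl
initL++lastL x (y ∷ ys) = cong (x ∷_) (initL++lastL y ys)

-- `filterᵇ` written by direct recursion, so that it computes under `with p x`.
select : (ℕ → Bool) → List ℕ → List ℕ
select p [] = []
select p (x ∷ xs) = if p x then x ∷ select p xs else select p xs

filterᵇ≡select : ∀ p xs → filterᵇ p xs ≡ select p xs
filterᵇ≡select p [] = refl
filterᵇ≡select p (x ∷ xs) with p x
... | true = cong (x ∷_) (filterᵇ≡select p xs)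
... | false = filterᵇ≡select p xs

select-++ : ∀ p u v → select p (u ++ v) ≡ select p u ++ select p v
select-++ p [] v = refl
select-++ p (x ∷ u) v with p x
... | true = cong (x ∷_) (select-++ p u v)
... | false = select-++ p u v

reverse-select : ∀ p v → reverse (select p v) ≡ select p (reverse v)
reverse-select p [] = refl
reverse-select p (x ∷ v) rewrite unfold-reverse x v | select-++ p (reverse v) (x ∷ []) with p x
... | true = trans (unfold-reverse x (select p v)) (cong (_++ x ∷ []) (reverse-select p v))
... | false = trans (reverse-select p v) (sym (++-identityʳ _))

select-all : ∀ p u → All (λ x → T (p x)) u → select p u ≡ u
select-all p [] _ = refl
select-all p (x ∷ u) (q ∷ qs) with p x
... | true = cong (x ∷_) (select-all p u qs)

select-none : ∀ p u → All (λ x → p x ≡ false) u → select p u ≡ []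
select-none p [] _ = refl
select-none p (x ∷ u) (e ∷ es) rewrite e = select-none p u es

select-All : ∀ {P : ℕ → Set} p u → All P u → All P (select p u)
select-All p [] _ = []
select-All p (x ∷ u) (q ∷ qs) with p x
... | true = q ∷ select-All p u qs
... | false = select-All p u qs

select-T : ∀ p u → All (λ x → T (p x)) (select p u)
select-T p [] = []
select-T p (x ∷ u) with p x in e
... | true = subst T (sym e) tt ∷ select-T p u
... | false = select-T p u

-- The state is a stack, top first; reading
-- a letter `a` pops (and outputs) the entries below `a` from the top and then
-- pushes `a`.  `machine s w` is the output followed by the final stack.

popped : ℕ → List ℕ → List ℕ
popped a [] = []
popped a (x ∷ s) = if x <ᵇ a then x ∷ popped a s else []

kept : ℕ → List ℕ → List ℕ
kept a [] = []
kept a (x ∷ s) = if x <ᵇ a then kept a s else x ∷ s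

output : List ℕ → List ℕ → List ℕ
output s [] = []
output s (a ∷ w) = popped a s ++ output (a ∷ kept a s) w

stack : List ℕ → List ℕ → List ℕ
stack s [] = s
stack s (a ∷ w) = stack (a ∷ kept a s) w

machine : List ℕ → List ℕ → List ℕ
machine s w = output s w ++ stack s w

output-++ : ∀ s u v → output s (u ++ v) ≡ output s u ++ output (stack s u) v
output-++ s [] v = refl
output-++ s (a ∷ u) v rewrite output-++ (a ∷ kept a s) u v = sym (++-assoc (popped a s) _ _)

stack-++ : ∀ s u v → stack s (u ++ v) ≡ stack (stack s u) v
stack-++ s [] v = refl
stack-++ s (a ∷ u) v = stack-++ (a ∷ kept a s) u v

output-∷ʳ : ∀ s w a → output s (w ++ a ∷ []) ≡ output s w ++ popped a (stack s w)
output-∷ʳ s w a = trans (output-++ s w (a ∷ [])) (cong (output s w ++_) (++-identityʳ _))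

stack-∷ʳ : ∀ s w a → stack s (w ++ a ∷ []) ≡ a ∷ kept a (stack s w)
stack-∷ʳ s w a = stack-++ s w (a ∷ [])

popped++kept : ∀ a s → popped a s ++ kept a s ≡ s
popped++kept a [] = refl
popped++kept a (x ∷ s) with x <ᵇ a
... | true = cong (x ∷_) (popped++kept a s)
... | false = refl

kept-All : ∀ {P : ℕ → Set} a s → All P s → All P (kept a s)
kept-All a [] ps = []
kept-All a (x ∷ s) (p ∷ ps) with x <ᵇ a
... | true = kept-All a s ps
... | false = p ∷ ps

stack-All : ∀ {P : ℕ → Set} s w → All P s → All P w → All P (stack s w)
stack-All s [] ps _ = ps
stack-All s (a ∷ w) ps (q ∷ qs) = stack-All (a ∷ kept a s) w (q ∷ kept-All a s ps) qs

popped-all< : ∀ m s → All (_< m) s → popped m s ≡ s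
popped-all< m [] _ = refl
popped-all< m (x ∷ s) (p ∷ ps) rewrite <ᵇ-true p = cong (x ∷_) (popped-all< m s ps)

kept-all< : ∀ m s → All (_< m) s → kept m s ≡ []
kept-all< m [] _ = refl
kept-all< m (x ∷ s) (p ∷ ps) rewrite <ᵇ-true p = kept-all< m s ps

popped-under : ∀ a m u → a ≤ m → popped a (u ++ [ m ]) ≡ popped a u
popped-under a m [] p rewrite <ᵇ-false p = refl
popped-under a m (x ∷ u) p with x <ᵇ a
... | true = cong (x ∷_) (popped-under a m u p)
... | false = refl

kept-under : ∀ a m u → a ≤ m → kept a (u ++ [ m ]) ≡ kept a u ++ [ m ]
kept-under a m [] p rewrite <ᵇ-false p = refl
kept-under a m (x ∷ u) p with x <ᵇ a
... | true = kept-under a m u p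
... | false = refl

output-under : ∀ m u R → All (_≤ m) R → output (u ++ [ m ]) R ≡ output u R
output-under m u [] _ = refl
output-under m u (a ∷ R) (p ∷ ps)
  rewrite popped-under a m u p | kept-under a m u p = cong (popped a u ++_) (output-under m (a ∷ kept a u) R ps)

stack-under : ∀ m u R → All (_≤ m) R → stack (u ++ [ m ]) R ≡ stack u R ++ [ m ]
stack-under m u [] _ = refl
stack-under m u (a ∷ R) (p ∷ ps)
  rewrite kept-under a m u p = stack-under m (a ∷ kept a u) R ps

machine-split : ∀ L m R → All (_< m) L → All (_≤ m) R →
            machine [] (L ++ m ∷ R) ≡ machine [] L ++ machine [] R ++ [ m ]
machine-split L m R pL pR =
  begin
    output [] (L ++ m ∷ R) ++ stack [] (L ++ m ∷ R)
  ≡⟨ cong₂ _++_ (output-++ [] L (m ∷ R)) (stack-++ [] L (m ∷ R)) ⟩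
    (output [] L ++ (popped m TL ++ output (m ∷ kept m TL) R)) ++ stack (m ∷ kept m TL) R
  ≡⟨ cong (λ z → (output [] L ++ (popped m TL ++ output (m ∷ z) R)) ++ stack (m ∷ z) R) (kept-all< m TL allTL) ⟩
    (output [] L ++ (popped m TL ++ output [ m ] R)) ++ stack [ m ] R
  ≡⟨ cong₂ (λ a b → (output [] L ++ (a ++ b)) ++ stack [ m ] R) (popped-all< m TL allTL) (output-under m [] R pR) ⟩
    (output [] L ++ (TL ++ output [] R)) ++ stack [ m ] R
  ≡⟨ cong ((output [] L ++ (TL ++ output [] R)) ++_) (stack-under m [] R pR) ⟩
    (output [] L ++ (TL ++ output [] R)) ++ (stack [] R ++ [ m ])
  ≡⟨ ++-assoc (output [] L) _ _ ⟩
    output [] L ++ ((TL ++ output [] R) ++ (stack [] R ++ [ m ]))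
  ≡⟨ cong (output [] L ++_) (++-assoc TL _ _) ⟩
    output [] L ++ (TL ++ (output [] R ++ (stack [] R ++ [ m ])))
  ≡⟨ sym (++-assoc (output [] L) TL _) ⟩
    (output [] L ++ TL) ++ (output [] R ++ (stack [] R ++ [ m ]))
  ≡⟨ cong ((output [] L ++ TL) ++_) (sym (++-assoc (output [] R) _ _)) ⟩
    (output [] L ++ TL) ++ ((output [] R ++ stack [] R) ++ [ m ])
  ∎
  where
    open ≡-Reasoning
    TL = stack [] L
    allTL : All (_< m) TL
    allTL = stack-All [] L [] pL

machine↭ : ∀ s w → machine s w ↭ s ++ w
machine↭ s [] = ↭-reflexive (sym (++-identityʳ s))
machine↭ s (a ∷ w) = begin
    machine s (a ∷ w)
  ≡⟨ ++-assoc (popped a s) _ _ ⟩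
    popped a s ++ machine (a ∷ kept a s) w
  ↭⟨ PermP.++⁺ˡ (popped a s) (machine↭ (a ∷ kept a s) w) ⟩
    popped a s ++ a ∷ kept a s ++ w
  ↭⟨ PermP.shift a (popped a s) (kept a s ++ w) ⟩
    a ∷ popped a s ++ kept a s ++ w
  ≡⟨ cong (a ∷_) (trans (sym (++-assoc (popped a s) (kept a s) w)) (cong (_++ w) (popped++kept a s))) ⟩
    a ∷ s ++ w
  ↭⟨ ↭-sym (PermP.shift a s w) ⟩
    s ++ a ∷ w
  ∎
  where open PermutationReasoning

popped-map : ∀ (f : ℕ → ℕ) a b s → (∀ x → (f x <ᵇ b) ≡ (x <ᵇ a)) → popped b (map f s) ≡ map f (popped a s)
popped-map f a b [] h = refl
popped-map f a b (x ∷ s) h rewrite h x with x <ᵇ a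
... | true = cong (f x ∷_) (popped-map f a b s h)
... | false = refl

kept-map : ∀ (f : ℕ → ℕ) a b s → (∀ x → (f x <ᵇ b) ≡ (x <ᵇ a)) → kept b (map f s) ≡ map f (kept a s)
kept-map f a b [] h = refl
kept-map f a b (x ∷ s) h rewrite h x with x <ᵇ a
... | true = kept-map f a b s h
... | false = refl

output-map : ∀ (f : ℕ → ℕ) → (∀ x y → (f x <ᵇ f y) ≡ (x <ᵇ y)) → ∀ s w → output (map f s) (map f w) ≡ map f (output s w)
output-map f h s [] = refl
output-map f h s (a ∷ w) rewrite popped-map f a (f a) s (λ x → h x a) | kept-map f a (f a) s (λ x → h x a)
  = trans (cong (map f (popped a s) ++_) (output-map f h (a ∷ kept a s) w)) (sym (map-++ f (popped a s) _))

stack-map : ∀ (f : ℕ → ℕ) → (∀ x y → (f x <ᵇ f y) ≡ (x <ᵇ y)) → ∀ s w → stack (map f s) (map f w) ≡ map f (stack s w)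
stack-map f h s [] = refl
stack-map f h s (a ∷ w) rewrite kept-map f a (f a) s (λ x → h x a) = stack-map f h (a ∷ kept a s) w

splitAtMax-≡ : ∀ m w → Any (m ≡_) w →
  w ≡ proj₁ (splitAtMax m w) ++ m ∷ proj₂ (splitAtMax m w)
splitAtMax-≡ m [] ()
splitAtMax-≡ m (x ∷ xs) m∈ with m ≡ᵇ x in e
... | true = cong (_∷ xs) (sym (≡ᵇ-true⁻ e))
... | false with splitAtMax m xs | splitAtMax-≡ m xs
...   | L , R | ih with m∈
...     | here m≡x = ⊥-elim (≡ᵇ-false⁻ e m≡x)
...     | there m∈xs = cong (x ∷_) (ih m∈xs)

splitAtMax-left : ∀ m w → All (m ≢_) (proj₁ (splitAtMax m w))
splitAtMax-left m [] = []
splitAtMax-left m (x ∷ xs) with m ≡ᵇ x in e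
... | true = []
... | false with splitAtMax m xs | splitAtMax-left m xs
...   | L , R | ih = ≡ᵇ-false⁻ e ∷ ih

maxL-∈ : ∀ x xs → Any (maxL (x ∷ xs) ≡_) (x ∷ xs)
maxL-∈ x [] = here (⊔-identityʳ x)
maxL-∈ x (y ∷ ys) with ⊔-sel x (maxL (y ∷ ys))
... | inj₁ p = here p
... | inj₂ p = there (subst (λ z → Any (z ≡_) (y ∷ ys)) (sym p) (maxL-∈ y ys))

maxL-≥ : ∀ w → All (_≤ maxL w) w
maxL-≥ [] = []
maxL-≥ (x ∷ xs) = m≤m⊔n x (maxL xs) ∷ AllM.map (λ p → ≤-trans p (m≤n⊔m x (maxL xs))) (maxL-≥ xs)

splitAtMax-maximum : ∀ x xs → let m = maxL (x ∷ xs) ; L = proj₁ (splitAtMax m (x ∷ xs)) ; R = proj₂ (splitAtMax m (x ∷ xs)) in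
  (x ∷ xs ≡ L ++ m ∷ R) × All (_< m) L × All (_≤ m) R
splitAtMax-maximum x xs
  with splitAtMax (maxL (x ∷ xs)) (x ∷ xs)
     | splitAtMax-≡ (maxL (x ∷ xs)) (x ∷ xs) (maxL-∈ x xs)
     | splitAtMax-left (maxL (x ∷ xs)) (x ∷ xs)
... | L , R | w≡LmR | m∉L = w≡LmR , L<m , AllM.tail (AllP.++⁻ʳ L ≤m)
  where
    m = maxL (x ∷ xs)
    ≤m : All (_≤ m) (L ++ m ∷ R)
    ≤m = subst (All (_≤ m)) w≡LmR (maxL-≥ (x ∷ xs))
    L<m : All (_< m) L
    L<m = AllM.zipWith (λ { (y≤m , m≢y) → ≤∧≢⇒< y≤m (λ y≡m → m≢y (sym y≡m)) }) (AllP.++⁻ˡ L ≤m , m∉L)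

length-split : ∀ (L : List ℕ) (m : ℕ) (R : List ℕ) (f : ℕ) → length (L ++ m ∷ R) ≤ suc f → length L ≤ f × length R ≤ f
length-split L m R f lp = ≤-pred (≤-trans (≤-trans (m≤m+n (suc (length L)) (length R)) (≤-reflexive (sym len))) lp)
                     , ≤-pred (≤-trans (≤-trans (s≤s (m≤n+m (length R) (length L))) (≤-reflexive (sym len))) lp)
  where
    len : length (L ++ m ∷ R) ≡ suc (length L + length R)
    len = trans (length-++ L) (+-suc (length L) (length R))

S′≡machine : ∀ f w → length w ≤ f → S′ f w ≡ machine [] w
S′≡machine zero [] _ = refl
S′≡machine zero (x ∷ xs) ()
S′≡machine (suc f) [] _ = refl
S′≡machine (suc f) (x ∷ xs) |w|≤ with splitAtMax (maxL (x ∷ xs)) (x ∷ xs) | splitAtMax-maximum x xs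
... | L , R | w≡LmR , L<m , R≤m = begin
    S′ f L ++ S′ f R ++ [ m ]
  ≡⟨ cong₂ (λ a b → a ++ b ++ [ m ]) (S′≡machine f L (proj₁ |LR|≤)) (S′≡machine f R (proj₂ |LR|≤)) ⟩
    machine [] L ++ machine [] R ++ [ m ]
  ≡⟨ sym (machine-split L m R L<m R≤m) ⟩
    machine [] (L ++ m ∷ R)
  ≡⟨ cong (machine []) (sym w≡LmR) ⟩
    machine [] (x ∷ xs)
  ∎
  where
    open ≡-Reasoning
    m = maxL (x ∷ xs)
    |LR|≤ = length-split L m R f (subst (λ w → length w ≤ suc f) w≡LmR |w|≤)

stackSort≡machine : ∀ w → stackSort w ≡ machine [] w
stackSort≡machine w = S′≡machine (length w) w ≤-refl

stackSort↭ : ∀ w → stackSort w ↭ w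
stackSort↭ w rewrite stackSort≡machine w = machine↭ [] w

HasPair : (ℕ → ℕ → Set) → List ℕ → Set
HasPair Q [] = ⊥
HasPair Q (y ∷ w) = Any (Q y) w ⊎ HasPair Q w

HasTriple : (ℕ → ℕ → ℕ → Set) → List ℕ → Set
HasTriple R [] = ⊥
HasTriple R (x ∷ w) = HasPair (R x) w ⊎ HasTriple R w

HasPair-++⁻ : ∀ {Q} u v → HasPair Q (u ++ v) → HasPair Q u ⊎ HasPair Q v ⊎ Any (λ x → Any (Q x) v) u
HasPair-++⁻ [] v p = inj₂ (inj₁ p)
HasPair-++⁻ (x ∷ u) v (inj₁ a) with AnyP.++⁻ u a
... | inj₁ a1 = inj₁ (inj₁ a1)
... | inj₂ a2 = inj₂ (inj₂ (here a2))
HasPair-++⁻ (x ∷ u) v (inj₂ p) with HasPair-++⁻ u v p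
... | inj₁ q = inj₁ (inj₂ q)
... | inj₂ (inj₁ q) = inj₂ (inj₁ q)
... | inj₂ (inj₂ q) = inj₂ (inj₂ (there q))

HasPair-++ˡ : ∀ {Q} u v → HasPair Q u → HasPair Q (u ++ v)
HasPair-++ˡ (x ∷ u) v (inj₁ a) = inj₁ (AnyP.++⁺ˡ a)
HasPair-++ˡ (x ∷ u) v (inj₂ p) = inj₂ (HasPair-++ˡ u v p)

HasPair-++ʳ : ∀ {Q} u v → HasPair Q v → HasPair Q (u ++ v)
HasPair-++ʳ [] v p = p
HasPair-++ʳ (x ∷ u) v p = inj₂ (HasPair-++ʳ u v p)

HasPair-++ᵐ : ∀ {Q} u v → Any (λ x → Any (Q x) v) u → HasPair Q (u ++ v)
HasPair-++ᵐ (x ∷ u) v (here a) = inj₁ (AnyP.++⁺ʳ u a)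
HasPair-++ᵐ (x ∷ u) v (there a) = inj₂ (HasPair-++ᵐ u v a)

HasPair-mono : ∀ {Q Q′} → (∀ {x y} → Q x y → Q′ x y) → ∀ w → HasPair Q w → HasPair Q′ w
HasPair-mono f (y ∷ w) (inj₁ a) = inj₁ (AnyM.map f a)
HasPair-mono f (y ∷ w) (inj₂ p) = inj₂ (HasPair-mono f w p)

HasPair-map⁻ : ∀ {Q} (f : ℕ → ℕ) w → HasPair Q (map f w) → HasPair (λ x y → Q (f x) (f y)) w
HasPair-map⁻ f (y ∷ w) (inj₁ a) = inj₁ (AnyP.map⁻ a)
HasPair-map⁻ f (y ∷ w) (inj₂ p) = inj₂ (HasPair-map⁻ f w p)

HasPair-map⁺ : ∀ {Q} (f : ℕ → ℕ) w → HasPair (λ x y → Q (f x) (f y)) w → HasPair Q (map f w)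
HasPair-map⁺ f (y ∷ w) (inj₁ a) = inj₁ (AnyP.map⁺ a)
HasPair-map⁺ f (y ∷ w) (inj₂ p) = inj₂ (HasPair-map⁺ f w p)

HasPair-first : ∀ {Q} w → HasPair Q w → Any (λ y → ∃ λ z → Q y z) w
HasPair-first (y ∷ w) (inj₁ a) = here (AnyM.satisfied a)
HasPair-first (y ∷ w) (inj₂ p) = there (HasPair-first w p)

HasPair-second∷ : ∀ {Q} y0 w → HasPair Q (y0 ∷ w) → Any (λ z → ∃ λ y → Q y z) w
HasPair-second∷ y0 w (inj₁ a) = AnyM.map (λ q → y0 , q) a
HasPair-second∷ y0 (y ∷ w) (inj₂ p) = there (HasPair-second∷ y w p)

HasPair-second : ∀ {Q′} w → HasPair Q′ w → Any (λ z → ∃ λ y → Q′ y z) w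
HasPair-second (y ∷ w) p = there (HasPair-second∷ y w p)

HasPair-⊎ : ∀ {A B : ℕ → ℕ → Set} w → HasPair (λ x y → A x y ⊎ B x y) w → HasPair A w ⊎ HasPair B w
HasPair-⊎ (y ∷ w) (inj₁ a) with AnyP.Any-⊎⁻ a
... | inj₁ p = inj₁ (inj₁ p)
... | inj₂ r = inj₂ (inj₁ r)
HasPair-⊎ (y ∷ w) (inj₂ p) with HasPair-⊎ w p
... | inj₁ q = inj₁ (inj₂ q)
... | inj₂ q = inj₂ (inj₂ q)

HasPair-monoᴬ : ∀ {P : ℕ → Set} {Q1 Q2 : ℕ → ℕ → Set} w → All P w → (∀ {x y} → P x → Q1 x y → Q2 x y) → HasPair Q1 w → HasPair Q2 w
HasPair-monoᴬ (x ∷ w) (px ∷ pw) f (inj₁ a) = inj₁ (AnyM.map (f px) a)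
HasPair-monoᴬ (x ∷ w) (px ∷ pw) f (inj₂ p) = inj₂ (HasPair-monoᴬ w pw f p)

HasTriple-++⁻ : ∀ {R} u v → HasTriple R (u ++ v) →
  HasTriple R u ⊎ HasTriple R v ⊎ Any (λ x → HasPair (R x) v) u ⊎ HasPair (λ x y → Any (R x y) v) u
HasTriple-++⁻ [] v t = inj₂ (inj₁ t)
HasTriple-++⁻ (x ∷ u) v (inj₁ p) with HasPair-++⁻ u v p
... | inj₁ q = inj₁ (inj₁ q)
... | inj₂ (inj₁ q) = inj₂ (inj₂ (inj₁ (here q)))
... | inj₂ (inj₂ q) = inj₂ (inj₂ (inj₂ (inj₁ q)))
HasTriple-++⁻ (x ∷ u) v (inj₂ t) with HasTriple-++⁻ u v t
... | inj₁ q = inj₁ (inj₂ q)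
... | inj₂ (inj₁ q) = inj₂ (inj₁ q)
... | inj₂ (inj₂ (inj₁ q)) = inj₂ (inj₂ (inj₁ (there q)))
... | inj₂ (inj₂ (inj₂ q)) = inj₂ (inj₂ (inj₂ (inj₂ q)))

HasTriple-++ˡ : ∀ {R} u v → HasTriple R u → HasTriple R (u ++ v)
HasTriple-++ˡ (x ∷ u) v (inj₁ p) = inj₁ (HasPair-++ˡ u v p)
HasTriple-++ˡ (x ∷ u) v (inj₂ t) = inj₂ (HasTriple-++ˡ u v t)

HasTriple-++ʳ : ∀ {R} u v → HasTriple R v → HasTriple R (u ++ v)
HasTriple-++ʳ [] v t = t
HasTriple-++ʳ (x ∷ u) v t = inj₂ (HasTriple-++ʳ u v t)

HasTriple-++ᵃ : ∀ {R} u v → Any (λ x → HasPair (R x) v) u → HasTriple R (u ++ v)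
HasTriple-++ᵃ (x ∷ u) v (here p) = inj₁ (HasPair-++ʳ u v p)
HasTriple-++ᵃ (x ∷ u) v (there a) = inj₂ (HasTriple-++ᵃ u v a)

HasTriple-++ᵇ : ∀ {R} u v → HasPair (λ x y → Any (R x y) v) u → HasTriple R (u ++ v)
HasTriple-++ᵇ (x ∷ u) v (inj₁ a) = inj₁ (HasPair-++ᵐ u v a)
HasTriple-++ᵇ (x ∷ u) v (inj₂ p) = inj₂ (HasTriple-++ᵇ u v p)

HasTriple-mono : ∀ {R R′} → (∀ {x y z} → R x y z → R′ x y z) → ∀ w → HasTriple R w → HasTriple R′ w
HasTriple-mono f (x ∷ w) (inj₁ p) = inj₁ (HasPair-mono f w p)
HasTriple-mono f (x ∷ w) (inj₂ t) = inj₂ (HasTriple-mono f w t)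

HasTriple-map⁻ : ∀ {R} (f : ℕ → ℕ) w → HasTriple R (map f w) → HasTriple (λ x y z → R (f x) (f y) (f z)) w
HasTriple-map⁻ f (x ∷ w) (inj₁ p) = inj₁ (HasPair-map⁻ f w p)
HasTriple-map⁻ f (x ∷ w) (inj₂ t) = inj₂ (HasTriple-map⁻ f w t)

HasTriple-map⁺ : ∀ {R} (f : ℕ → ℕ) w → HasTriple (λ x y z → R (f x) (f y) (f z)) w → HasTriple R (map f w)
HasTriple-map⁺ f (x ∷ w) (inj₁ p) = inj₁ (HasPair-map⁺ f w p)
HasTriple-map⁺ f (x ∷ w) (inj₂ t) = inj₂ (HasTriple-map⁺ f w t)

HasTriple-insert : ∀ {R} u a v → HasTriple R (u ++ v) → HasTriple R (u ++ a ∷ v)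
HasTriple-insert u a v t with HasTriple-++⁻ u v t
... | inj₁ q = HasTriple-++ˡ u _ q
... | inj₂ (inj₁ q) = HasTriple-++ʳ u _ (inj₂ q)
... | inj₂ (inj₂ (inj₁ q)) = HasTriple-++ᵃ u _ (AnyM.map inj₂ q)
... | inj₂ (inj₂ (inj₂ q)) = HasTriple-++ᵇ u _ (HasPair-mono there u q)

HasTriple-insert⁻ : ∀ {R} u a v → HasTriple R (u ++ a ∷ v) →
  HasTriple R (u ++ v) ⊎ HasPair (R a) v ⊎ Any (λ x → Any (R x a) v) u ⊎ HasPair (λ x y → R x y a) u
HasTriple-insert⁻ u a v t with HasTriple-++⁻ u (a ∷ v) t
... | inj₁ in-u = inj₁ (HasTriple-++ˡ u v in-u)
... | inj₂ (inj₁ (inj₁ a-y-z)) = inj₂ (inj₁ a-y-z)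
... | inj₂ (inj₁ (inj₂ in-v)) = inj₁ (HasTriple-++ʳ u v in-v)
... | inj₂ (inj₂ (inj₁ x-av)) with AnyP.Any-⊎⁻ x-av
...   | inj₁ x-a-z = inj₂ (inj₂ (inj₁ x-a-z))
...   | inj₂ x-v = inj₁ (HasTriple-++ᵃ u v x-v)
HasTriple-insert⁻ u a v t | inj₂ (inj₂ (inj₂ xy-av))
  with HasPair-⊎ u (HasPair-mono (λ { (here z≡a) → inj₁ z≡a ; (there z∈v) → inj₂ z∈v }) u xy-av)
...   | inj₁ x-y-a = inj₂ (inj₂ (inj₂ x-y-a))
...   | inj₂ xy-v = inj₁ (HasTriple-++ᵇ u v xy-v)

HasPair-reverse : ∀ {Q} w → HasPair Q (reverse w) → HasPair (λ y z → Q z y) w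
HasPair-reverse [] ()
HasPair-reverse {Q} (x ∷ w) p with HasPair-++⁻ (reverse w) (x ∷ []) (subst (HasPair Q) (unfold-reverse x w) p)
... | inj₁ q = inj₂ (HasPair-reverse w q)
... | inj₂ (inj₁ (inj₁ ()))
... | inj₂ (inj₁ (inj₂ ()))
... | inj₂ (inj₂ q) = inj₁ (AnyP.reverse⁻ (AnyM.map (λ { (here e) → e }) q))

HasTriple-reverse⁻ : ∀ {R} w → HasTriple R (reverse w) → HasTriple (λ x y z → R z y x) w
HasTriple-reverse⁻ [] ()
HasTriple-reverse⁻ {R} (x ∷ w) t with HasTriple-++⁻ (reverse w) (x ∷ []) (subst (HasTriple R) (unfold-reverse x w) t)
... | inj₁ q = inj₂ (HasTriple-reverse⁻ w q)
... | inj₂ (inj₁ (inj₁ ()))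
... | inj₂ (inj₁ (inj₂ ()))
... | inj₂ (inj₂ (inj₁ q)) = ⊥-elim (noPair q)
  where
    noPair : Any (λ a → HasPair (R a) (x ∷ [])) (reverse w) → ⊥
    noPair a with AnyM.satisfied a
    ... | _ , inj₁ ()
    ... | _ , inj₂ ()
... | inj₂ (inj₂ (inj₂ q)) =
  inj₁ (HasPair-reverse w (HasPair-mono (λ { (here e) → e }) (reverse w) q))

HasTriple-reverse⁺ : ∀ {R} w → HasTriple (λ x y z → R z y x) w → HasTriple R (reverse w)
HasTriple-reverse⁺ {R} w t = HasTriple-reverse⁻ {λ x y z → R z y x} (reverse w) (subst (HasTriple _) (sym (reverse-involutive w)) t)

P231 : ℕ → ℕ → ℕ → Set
P231 x y z = z < x × x < y

P132 : ℕ → ℕ → ℕ → Set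
P132 x y z = x < z × z < y

Sorted : List ℕ → Set
Sorted [] = ⊤
Sorted (x ∷ w) = All (x ≤_) w × Sorted w

Distinct : List ℕ → Set
Distinct [] = ⊤
Distinct (x ∷ w) = All (x ≢_) w × Distinct w

Increasing : List ℕ → Set
Increasing [] = ⊤
Increasing (x ∷ w) = All (x <_) w × Increasing w

Decreasing : List ℕ → Set
Decreasing [] = ⊤
Decreasing (v ∷ V) = All (_< v) V × Decreasing V

Sorted-++⁻ : ∀ u v → Sorted (u ++ v) → Sorted u × Sorted v × All (λ x → All (x ≤_) v) u
Sorted-++⁻ [] v s = tt , s , []
Sorted-++⁻ (x ∷ u) v (a , s) with Sorted-++⁻ u v s
... | su , sv , c = (AllP.++⁻ˡ u a , su) , sv , AllP.++⁻ʳ u a ∷ c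

Sorted-++⁺ : ∀ u v → Sorted u → Sorted v → All (λ x → All (x ≤_) v) u → Sorted (u ++ v)
Sorted-++⁺ [] v _ sv _ = sv
Sorted-++⁺ (x ∷ u) v (a , su) sv (c ∷ cs) = AllP.++⁺ a c , Sorted-++⁺ u v su sv cs

Distinct-++⁻ : ∀ u v → Distinct (u ++ v) → Distinct u × Distinct v × All (λ x → All (x ≢_) v) u
Distinct-++⁻ [] v d = tt , d , []
Distinct-++⁻ (x ∷ u) v (a , d) with Distinct-++⁻ u v d
... | du , dv , c = (AllP.++⁻ˡ u a , du) , dv , AllP.++⁻ʳ u a ∷ c

Distinct-++⁺ : ∀ u v → Distinct u → Distinct v → All (λ x → All (x ≢_) v) u → Distinct (u ++ v)
Distinct-++⁺ [] v _ dv _ = dv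
Distinct-++⁺ (x ∷ u) v (a , du) dv (c ∷ cs) = AllP.++⁺ a c , Distinct-++⁺ u v du dv cs

Increasing-++⁻ : ∀ u v → Increasing (u ++ v) → Increasing u × Increasing v × All (λ x → All (x <_) v) u
Increasing-++⁻ [] v s = tt , s , []
Increasing-++⁻ (x ∷ u) v (a , s) with Increasing-++⁻ u v s
... | su , sv , c = (AllP.++⁻ˡ u a , su) , sv , AllP.++⁻ʳ u a ∷ c

Distinct-resp-↭ : ∀ {u v} → u ↭ v → Distinct u → Distinct v
Distinct-resp-↭ ↭.refl d = d
Distinct-resp-↭ (↭.prep x p) (x∉ , d) = PermP.All-resp-↭ p x∉ , Distinct-resp-↭ p d
Distinct-resp-↭ (↭.swap x y p) ((x≢y ∷ x∉) , (y∉ , d)) =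
  ((λ y≡x → x≢y (sym y≡x)) ∷ PermP.All-resp-↭ p y∉) , (PermP.All-resp-↭ p x∉ , Distinct-resp-↭ p d)
Distinct-resp-↭ (↭.trans p q) d = Distinct-resp-↭ q (Distinct-resp-↭ p d)

Distinct-map : ∀ {P : ℕ → Set} (f : ℕ → ℕ) → (∀ {x y} → P x → P y → f x ≡ f y → x ≡ y) →
           ∀ w → All P w → Distinct w → Distinct (map f w)
Distinct-map f inj [] _ _ = tt
Distinct-map f inj (x ∷ w) (px ∷ pw) (x∉w , d) = fx∉ w pw x∉w , Distinct-map f inj w pw d
  where
    fx∉ : ∀ v → All _ v → All (x ≢_) v → All (f x ≢_) (map f v)
    fx∉ [] _ _ = []
    fx∉ (y ∷ v) (py ∷ pv) (x≢y ∷ x∉v) = (λ fx≡fy → x≢y (inj px py fx≡fy)) ∷ fx∉ v pv x∉v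

sorted⇒increasing : ∀ w → Sorted w → Distinct w → Increasing w
sorted⇒increasing [] _ _ = tt
sorted⇒increasing (x ∷ w) (x≤w , s) (x∉w , d) =
  AllM.zipWith (λ { (x≤y , x≢y) → ≤∧≢⇒< x≤y x≢y }) (x≤w , x∉w) , sorted⇒increasing w s d

Increasing-select : ∀ p u → Increasing u → Increasing (select p u)
Increasing-select p [] _ = tt
Increasing-select p (x ∷ u) (a , s) with p x
... | true = select-All p u a , Increasing-select p u s
... | false = Increasing-select p u s

-- Knuth's theorem: S(w) is sorted if and only if w avoids 231.  By strong
-- induction on |w|, using the decomposition w = L m R at the maximum: both
-- properties hold for L m R exactly when they hold for L and for R and every
-- letter of L is at most every letter of R.

_≼_ : List ℕ → List ℕ → Set
u ≼ v = All (λ x → All (x ≤_) v) u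

≼-resp-↭ : ∀ {u u′ v v′} → u ↭ u′ → v ↭ v′ → u ≼ v → u′ ≼ v′
≼-resp-↭ u↭u′ v↭v′ u≼v = PermP.All-resp-↭ u↭u′ (AllM.map (λ x≤v → PermP.All-resp-↭ v↭v′ x≤v) u≼v)

avoids231-split⁻ : ∀ L m R → All (_< m) L → ¬ HasTriple P231 (L ++ m ∷ R) →
  ¬ HasTriple P231 L × ¬ HasTriple P231 R × L ≼ R
avoids231-split⁻ L m R L<m no231 =
  (λ t → no231 (HasTriple-++ˡ L _ t)) , (λ t → no231 (HasTriple-++ʳ L _ (inj₂ t))) ,
  AllM.tabulate (λ x∈L → AllM.tabulate (λ z∈R → x≤z x∈L z∈R))
  where
    -- x ∈ L above z ∈ R would give the 231 occurrence x m z
    x≤z : ∀ {x z} → x ∈ L → z ∈ R → x ≤ z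
    x≤z {x} {z} x∈L z∈R with x ≤? z
    ... | yes x≤z = x≤z
    ... | no x≰z = ⊥-elim (no231 (HasTriple-++ᵃ L (m ∷ R)
            (AnyM.map (λ { refl → inj₁ (AnyM.map (λ { refl → ≰⇒> x≰z , AllM.lookup L<m x∈L }) z∈R) }) x∈L)))

avoids231-split⁺ : ∀ L m R → All (_< m) L → All (_≤ m) R →
  ¬ HasTriple P231 L → ¬ HasTriple P231 R → L ≼ R → ¬ HasTriple P231 (L ++ m ∷ R)
avoids231-split⁺ L m R L<m R≤m noL noR L≼R t with HasTriple-++⁻ L (m ∷ R) t
... | inj₁ tL = noL tL
... | inj₂ (inj₁ (inj₂ tR)) = noR tR
... | inj₂ (inj₁ (inj₁ m-y-z)) with All-Any R≤m (HasPair-first R m-y-z)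
...   | _ , y≤m , _ , _ , m<y = <⇒≱ m<y y≤m
avoids231-split⁺ L m R L<m R≤m noL noR L≼R t | inj₂ (inj₂ (inj₁ x-yz)) with All-Any L≼R x-yz
...   | _ , x≤R , y-z with All-Any x≤R (HasPair-second∷ m R y-z)
...     | _ , x≤z , _ , z<x , _ = <⇒≱ z<x x≤z
avoids231-split⁺ L m R L<m R≤m noL noR L≼R t | inj₂ (inj₂ (inj₂ xy-z)) with All-Any (AllM.zip (L<m , L≼R)) (HasPair-first L xy-z)
...   | _ , (x<m , _) , _ , here (m<x , _) = <-asym m<x x<m
...   | _ , (_ , x≤R) , _ , there z∈R with All-Any x≤R z∈R
...     | _ , x≤z , z<x , _ = <⇒≱ z<x x≤z

sortedImage-split⁻ : ∀ L m R → Sorted (machine [] L ++ machine [] R ++ m ∷ []) →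
  Sorted (machine [] L) × Sorted (machine [] R) × L ≼ R
sortedImage-split⁻ L m R s with Sorted-++⁻ (machine [] L) _ s
... | sL , sRm , cross = sL , proj₁ (Sorted-++⁻ (machine [] R) (m ∷ []) sRm) ,
      ≼-resp-↭ (machine↭ [] L) (machine↭ [] R) (AllM.map (AllP.++⁻ˡ (machine [] R)) cross)

sortedImage-split⁺ : ∀ L m R → All (_< m) L → All (_≤ m) R →
  Sorted (machine [] L) → Sorted (machine [] R) → L ≼ R → Sorted (machine [] L ++ machine [] R ++ m ∷ [])
sortedImage-split⁺ L m R L<m R≤m sL sR L≼R =
  Sorted-++⁺ _ _ sL (Sorted-++⁺ _ (m ∷ []) sR ([] , tt) (≼-resp-↭ (↭-sym (machine↭ [] R)) ↭-refl (AllM.map (_∷ []) R≤m)))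
    (≼-resp-↭ (↭-sym (machine↭ [] L)) ↭-refl
      (AllM.zipWith (λ { (x<m , x≤R) → AllP.++⁺ (PermP.All-resp-↭ (↭-sym (machine↭ [] R)) x≤R) (<⇒≤ x<m ∷ []) }) (L<m , L≼R)))

Knuth : List ℕ → Set
Knuth w = (Sorted (machine [] w) → ¬ HasTriple P231 w) × (¬ HasTriple P231 w → Sorted (machine [] w))

knuth-split : ∀ L m R → All (_< m) L → All (_≤ m) R → Knuth L → Knuth R → Knuth (L ++ m ∷ R)
knuth-split L m R L<m R≤m (sortedL⇒ , ⇒sortedL) (sortedR⇒ , ⇒sortedR) rewrite machine-split L m R L<m R≤m =
  (λ s → let (sL , sR , L≼R) = sortedImage-split⁻ L m R s in
         avoids231-split⁺ L m R L<m R≤m (sortedL⇒ sL) (sortedR⇒ sR) L≼R) ,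
  (λ n → let (nL , nR , L≼R) = avoids231-split⁻ L m R L<m n in
         sortedImage-split⁺ L m R L<m R≤m (⇒sortedL nL) (⇒sortedR nR) L≼R)

knuth : ∀ f w → length w ≤ f → Knuth w
knuth f [] _ = (λ _ ()) , (λ _ → tt)
knuth zero (x ∷ xs) ()
knuth (suc f) (x ∷ xs) |w|≤ with splitAtMax (maxL (x ∷ xs)) (x ∷ xs) | splitAtMax-maximum x xs
... | L , R | w≡LmR , L<m , R≤m =
  subst Knuth (sym w≡LmR) (knuth-split L m R L<m R≤m (knuth f L (proj₁ |LR|≤)) (knuth f R (proj₂ |LR|≤)))
  where
    m = maxL (x ∷ xs)
    |LR|≤ = length-split L m R f (subst (λ w → length w ≤ suc f) w≡LmR |w|≤)

sorted⇒avoids231 : ∀ w → Sorted (stackSort w) → ¬ HasTriple P231 w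
sorted⇒avoids231 w s rewrite stackSort≡machine w = proj₁ (knuth (length w) w ≤-refl) s

avoids231⇒sorted : ∀ w → ¬ HasTriple P231 w → Sorted (stackSort w)
avoids231⇒sorted w n rewrite stackSort≡machine w = proj₂ (knuth (length w) w ≤-refl) n

InRange : ℕ → ℕ → Set
InRange n a = 1 ≤ a × a ≤ n

IsPerm : ℕ → List ℕ → Set
IsPerm n σ = All (InRange n) σ × Distinct σ

distinctᵇ-sound : ∀ w → T (distinctᵇ w) → Distinct w
distinctᵇ-sound [] _ = tt
distinctᵇ-sound (x ∷ w) t with T-∧⁻ {not (anyᵇ (x ≡ᵇ_) w)} t
... | x∉w , dw = anyᵇ-false-sound x w (T-not⁻ x∉w) , distinctᵇ-sound w dw

distinctᵇ-complete : ∀ w → Distinct w → T (distinctᵇ w)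
distinctᵇ-complete [] _ = tt
distinctᵇ-complete (x ∷ w) (x∉w , dw) =
  T-∧⁺ {not (anyᵇ (x ≡ᵇ_) w)} (T-not⁺ (anyᵇ-false-complete x w x∉w)) (distinctᵇ-complete w dw)

isPermᵇ-sound : ∀ σ → T (isPermᵇ σ) → IsPerm (length σ) σ
isPermᵇ-sound σ t with T-∧⁻ {allᵇ (λ a → (1 ≤ᵇ a) ∧ (a ≤ᵇ length σ)) σ} t
... | inRange , dσ = AllM.map decode (allᵇ-sound _ σ inRange) , distinctᵇ-sound σ dσ
  where
    decode : ∀ {x} → T ((1 ≤ᵇ x) ∧ (x ≤ᵇ length σ)) → InRange (length σ) x
    decode {x} t with T-∧⁻ {1 ≤ᵇ x} t
    ... | p , q = ≤ᵇ⇒≤ 1 x p , ≤ᵇ⇒≤ x (length σ) q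

isPermᵇ-complete : ∀ σ → IsPerm (length σ) σ → T (isPermᵇ σ)
isPermᵇ-complete σ (inRange , dσ) = T-∧⁺ {allᵇ (λ a → (1 ≤ᵇ a) ∧ (a ≤ᵇ length σ)) σ}
   (allᵇ-complete _ σ (AllM.map (λ { {x} (p , q) → T-∧⁺ {1 ≤ᵇ x} (≤⇒≤ᵇ p) (≤⇒≤ᵇ q) }) inRange))
   (distinctᵇ-complete σ dσ)

IsPerm-resp-↭ : ∀ {n u v} → u ↭ v → IsPerm n u → IsPerm n v
IsPerm-resp-↭ p (a , d) = PermP.All-resp-↭ p a , Distinct-resp-↭ p d

increasing-bound : ∀ a w c → Increasing (a ∷ w) → All (_< c) (a ∷ w) → length w + suc a ≤ c
increasing-bound a [] c _ (ac ∷ _) = ac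
increasing-bound a (b ∷ w) c ((ab ∷ _) , s) (_ ∷ cs) =
  ≤-trans (≤-reflexive (sym (+-suc (length w) (suc a)))) (≤-trans (+-monoʳ-≤ (length w) (s≤s ab)) (increasing-bound b w c s cs))

-- The only increasing word of length `len` in [lo, lo+len) is lo, lo+1, …:
-- its first letter must be lo, since the remaining letters need room above it.
increasing-interval : ∀ lo len w → Increasing w → All (λ a → lo ≤ a × a < lo + len) w → length w ≡ len →
  w ≡ applyUpTo (lo +_) len
increasing-interval lo zero [] _ _ _ = refl
increasing-interval lo (suc len) (a ∷ w) (a<w , w↑) ((lo≤a , a<hi) ∷ w-range) |aw|≡ =
  cong₂ _∷_ (trans a≡lo (sym (+-identityʳ lo)))
    (trans (increasing-interval (suc lo) len w w↑ w-range′ (suc-injective |aw|≡)) (applyUpTo-cong _ _ len (λ x → sym (+-suc lo x))))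
  where
    bound : length w + suc a ≤ lo + suc len
    bound = increasing-bound a w (lo + suc len) (a<w , w↑) (a<hi ∷ AllM.map proj₂ w-range)
    bound′ : length w + suc a ≤ length w + suc lo
    bound′ = ≤-trans bound (≤-reflexive (trans (+-comm lo (suc len)) (trans (cong (λ z → suc z + lo) (sym (suc-injective |aw|≡))) (sym (+-suc (length w) lo)))))
    a≡lo : a ≡ lo
    a≡lo = ≤-antisym (≤-pred (+-cancelˡ-≤ (length w) _ _ bound′)) lo≤a
    w-range′ : All (λ x → suc lo ≤ x × x < suc lo + len) w
    w-range′ = AllM.map (λ { (p , q) → p , ≤-trans q (≤-reflexive (+-suc lo len)) })
            (AllM.zip (subst (λ z → All (z <_) w) a≡lo a<w , AllM.map proj₂ w-range))

interval-sorted : ∀ k n → Sorted (applyUpTo (k +_) n)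
interval-sorted k zero = tt
interval-sorted k (suc n) =
  AllP.applyUpTo⁺₂ (λ i → k + suc i) n (λ i → +-monoʳ-≤ k z≤n) ,
  subst Sorted (applyUpTo-cong _ _ n (λ i → sym (+-suc k i))) (interval-sorted (suc k) n)

idPerm≡applyUpTo : ∀ n → idPerm n ≡ applyUpTo (1 +_) n
idPerm≡applyUpTo n = map-upTo suc n

idPerm-sorted : ∀ n → Sorted (idPerm n)
idPerm-sorted n = subst Sorted (sym (idPerm≡applyUpTo n)) (interval-sorted 1 n)

∈idPerm : ∀ n u → InRange n u → Any (_≡ u) (idPerm n)
∈idPerm n (suc u) (_ , u<n) = AnyM.map sym (∈-map⁺ suc (∈-upTo⁺ u<n))

sorted-perm≡id : ∀ n w → Sorted w → IsPerm n w → length w ≡ n → w ≡ idPerm n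
sorted-perm≡id n w s (r , d) ln =
  trans (increasing-interval 1 n w (sorted⇒increasing w s d) (AllM.map (λ { (p , q) → p , s≤s q }) r) ln) (sym (idPerm≡applyUpTo n))

-- Both classes test whether a second pass of S
-- sorts S(σ): directly for SS, after reversal for SrS.  By Knuth, this says
-- that S(σ) avoids 231, respectively 132; `Forbidden c` is that pattern.

secondPass : Class → List ℕ → List ℕ
secondPass SS w = stackSort w
secondPass SrS w = stackSort (rev w)

Forbidden : Class → ℕ → ℕ → ℕ → Set
Forbidden SS = P231
Forbidden SrS = P132

secondPass↭ : ∀ c w → secondPass c w ↭ w
secondPass↭ SS w = stackSort↭ w
secondPass↭ SrS w rewrite rev≡reverse w = ↭-trans (stackSort↭ (reverse w)) (PermP.↭-reverse w)

secondPass-sorted⇒ : ∀ c w → Sorted (secondPass c w) → ¬ HasTriple (Forbidden c) w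
secondPass-sorted⇒ SS w s = sorted⇒avoids231 w s
secondPass-sorted⇒ SrS w s t rewrite rev≡reverse w = sorted⇒avoids231 (reverse w) s (HasTriple-reverse⁺ w t)

secondPass-sorted⇐ : ∀ c w → ¬ HasTriple (Forbidden c) w → Sorted (secondPass c w)
secondPass-sorted⇐ SS w n = avoids231⇒sorted w n
secondPass-sorted⇐ SrS w n rewrite rev≡reverse w = avoids231⇒sorted (reverse w) (λ t → n (HasTriple-reverse⁻ w t))

inCᵇ-secondPass : ∀ c σ → inCᵇ c σ ≡ isPermᵇ σ ∧ eqᵇ (secondPass c (stackSort σ)) (idPerm (length σ))
inCᵇ-secondPass SS σ = refl
inCᵇ-secondPass SrS σ = refl

InC-spec : ∀ c σ → InC c σ → IsPerm (length σ) σ × secondPass c (stackSort σ) ≡ idPerm (length σ)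
InC-spec c σ ic with T-∧⁻ {isPermᵇ σ} (subst T (inCᵇ-secondPass c σ) ic)
... | isPerm , sorts = isPermᵇ-sound σ isPerm , eqᵇ-sound _ _ sorts

avoidance⇒InC : ∀ c σ → IsPerm (length σ) σ → ¬ HasTriple (Forbidden c) (stackSort σ) → InC c σ
avoidance⇒InC c σ pm nt = subst T (sym (inCᵇ-secondPass c σ))
  (T-∧⁺ {isPermᵇ σ} (isPermᵇ-complete σ pm) (subst (λ w → T (eqᵇ w (idPerm (length σ)))) (sym sorts) (eqᵇ-refl (idPerm (length σ)))))
  where
    S²↭σ = ↭-trans (secondPass↭ c (stackSort σ)) (stackSort↭ σ)
    sorts : secondPass c (stackSort σ) ≡ idPerm (length σ)
    sorts = sorted-perm≡id (length σ) _ (secondPass-sorted⇐ c _ nt) (IsPerm-resp-↭ (↭-sym S²↭σ) pm) (PermP.↭-length S²↭σ)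

InC⇒avoidance : ∀ c σ → InC c σ → IsPerm (length σ) σ × ¬ HasTriple (Forbidden c) (stackSort σ)
InC⇒avoidance c σ ic with InC-spec c σ ic
... | pm , sorts = pm , secondPass-sorted⇒ c (stackSort σ) (subst Sorted (sym sorts) (idPerm-sorted (length σ)))

∈stackSort : ∀ c σ → InC c σ → ∀ u → InRange (length σ) u → Any (_≡ u) (stackSort σ)
∈stackSort c σ ic u r = PermP.Any-resp-↭ (secondPass↭ c (stackSort σ))
  (subst (Any (_≡ u)) (sym (proj₂ (InC-spec c σ ic))) (∈idPerm (length σ) u r))

rlMaxima-∷ʳ : ∀ w a → rlMaxima (w ++ a ∷ []) ≡ select (a <ᵇ_) (rlMaxima w) ++ a ∷ []
rlMaxima-∷ʳ [] a = refl
rlMaxima-∷ʳ (x ∷ w) a rewrite allᵇ-++ (_<ᵇ x) w (a ∷ []) with allᵇ (_<ᵇ x) w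
... | false = rlMaxima-∷ʳ w a
... | true with a <ᵇ x
...   | true = cong (x ∷_) (rlMaxima-∷ʳ w a)
...   | false = rlMaxima-∷ʳ w a

rlMaxima-All : ∀ {P : ℕ → Set} w → All P w → All P (rlMaxima w)
rlMaxima-All [] _ = []
rlMaxima-All (x ∷ w) (p ∷ ps) with allᵇ (_<ᵇ x) w
... | true = p ∷ rlMaxima-All w ps
... | false = rlMaxima-All w ps

kept≡select : ∀ a U → Increasing U → All (a ≢_) U → kept a U ≡ select (a <ᵇ_) U
kept≡select a [] _ _ = refl
kept≡select a (x ∷ U) (x<U , U↑) (a≢x ∷ a∉U) with x <ᵇ a in x<a | a <ᵇ x in a<x
... | true | true = ⊥-elim (<-asym (<ᵇ-true⁻ {x} {a} x<a) (<ᵇ-true⁻ {a} {x} a<x))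
... | true | false = kept≡select a U U↑ a∉U
... | false | true = sym (cong (x ∷_) (select-all (a <ᵇ_) U (AllM.map (λ x<y → <⇒<ᵇ (<-trans (<ᵇ-true⁻ a<x) x<y)) x<U)))
... | false | false = ⊥-elim (a≢x (≤-antisym (<ᵇ-false⁻ {x} {a} x<a) (<ᵇ-false⁻ {a} {x} a<x)))

StackInvariant : List ℕ → Set
StackInvariant w = Distinct w → stack [] w ≡ reverse (rlMaxima w) × Increasing (stack [] w)

stack≡rlMaxima : ∀ w → StackInvariant w
stack≡rlMaxima = snoc-induction StackInvariant (λ _ → refl , tt) step
  where
    step : ∀ w a → StackInvariant w → StackInvariant (w ++ a ∷ [])
    step w a ih wa-distinct with Distinct-++⁻ w (a ∷ []) wa-distinct
    ... | w-distinct , _ , w≢a with ih w-distinct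
    ...   | stack≡ , stack↑ = stack≡′ , stack↑′
      where
        open ≡-Reasoning
        V = rlMaxima w
        a∉V : All (a ≢_) (reverse V)
        a∉V = All-reverse V (rlMaxima-All w (AllM.map (λ { (x≢a ∷ []) → λ a≡x → x≢a (sym a≡x) }) w≢a))
        V↑ : Increasing (reverse V)
        V↑ = subst Increasing stack≡ stack↑
        kept≡ : kept a (stack [] w) ≡ select (a <ᵇ_) (reverse V)
        kept≡ = trans (cong (kept a) stack≡) (kept≡select a (reverse V) V↑ a∉V)
        stack≡′ : stack [] (w ++ a ∷ []) ≡ reverse (rlMaxima (w ++ a ∷ []))
        stack≡′ = begin
            stack [] (w ++ a ∷ [])
          ≡⟨ stack-∷ʳ [] w a ⟩
            a ∷ kept a (stack [] w)
          ≡⟨ cong (a ∷_) (trans kept≡ (sym (reverse-select (a <ᵇ_) V))) ⟩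
            a ∷ reverse (select (a <ᵇ_) V)
          ≡⟨ sym (reverse-++ (select (a <ᵇ_) V) (a ∷ [])) ⟩
            reverse (select (a <ᵇ_) V ++ a ∷ [])
          ≡⟨ cong reverse (sym (rlMaxima-∷ʳ w a)) ⟩
            reverse (rlMaxima (w ++ a ∷ []))
          ∎
        stack↑′ : Increasing (stack [] (w ++ a ∷ []))
        stack↑′ rewrite stack-∷ʳ [] w a | kept≡ =
          AllM.map (λ {x} a<x → <ᵇ⇒< a x a<x) (select-T (a <ᵇ_) (reverse V)) , Increasing-select (a <ᵇ_) (reverse V) V↑

-- Rightmost insertion.  `bump t` renames the values of π when t+1 is appended;
-- `unbump l` undoes it when the last letter l is deleted.

bump : ℕ → ℕ → ℕ
bump t a = if t <ᵇ a then suc a else a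

bump-<⁺ : ∀ t {x y} → x < y → bump t x < bump t y
bump-<⁺ t {x} {y} x<y with t <ᵇ x in tx | t <ᵇ y in ty
... | true | true = s≤s x<y
... | true | false = ⊥-elim (<⇒≱ (<-trans (<ᵇ-true⁻ tx) x<y) (<ᵇ-false⁻ ty))
... | false | true = m<n⇒m<1+n x<y
... | false | false = x<y

bump-<⁻ : ∀ t {x y} → bump t x < bump t y → x < y
bump-<⁻ t {x} {y} bx<by with <-cmp x y
... | tri< x<y _ _ = x<y
... | tri≈ _ refl _ = ⊥-elim (<-irrefl refl bx<by)
... | tri> _ _ y<x = ⊥-elim (<-asym bx<by (bump-<⁺ t y<x))

bump-<ᵇ : ∀ t x y → (bump t x <ᵇ bump t y) ≡ (x <ᵇ y)
bump-<ᵇ t x y = T-ext (λ b → <⇒<ᵇ (bump-<⁻ t {x} {y} (<ᵇ⇒< (bump t x) (bump t y) b))) (λ b → <⇒<ᵇ (bump-<⁺ t {x} {y} (<ᵇ⇒< x y b)))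

bump-injective : ∀ t x y → bump t x ≡ bump t y → x ≡ y
bump-injective t x y e with <-cmp x y
... | tri< x<y _ _ = ⊥-elim (<-irrefl e (bump-<⁺ t x<y))
... | tri≈ _ x≡y _ = x≡y
... | tri> _ _ y<x = ⊥-elim (<-irrefl (sym e) (bump-<⁺ t y<x))

bump-≢ : ∀ t x → bump t x ≢ suc t
bump-≢ t x e with t <ᵇ x in tx
... | true = <-irrefl (sym (suc-injective e)) (<ᵇ-true⁻ tx)
... | false = <-irrefl e (s≤s (<ᵇ-false⁻ tx))

bump-fix : ∀ t x → x ≤ t → bump t x ≡ x
bump-fix t x p rewrite <ᵇ-false {t} {x} p = refl

bump-shift : ∀ t x → t < x → bump t x ≡ suc x
bump-shift t x p rewrite <ᵇ-true p = refl

bump-gt⁻ : ∀ s x → suc s < bump s x → s < x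
bump-gt⁻ s x p with s <ᵇ x in e
... | true = <ᵇ-true⁻ e
... | false = ⊥-elim (<-asym p (s≤s (<ᵇ-false⁻ e)))

bump-lt⁻ : ∀ s x → bump s x < suc s → x ≤ s
bump-lt⁻ s x p with s <ᵇ x in e
... | true = ⊥-elim (<-asym p (s≤s (<ᵇ-true⁻ e)))
... | false = <ᵇ-false⁻ e

bump-gt⁺ : ∀ s x → s < x → suc s < bump s x
bump-gt⁺ s x p rewrite <ᵇ-true p = s≤s p

bump-le⁺ : ∀ s x → x ≤ s → bump s x < suc s
bump-le⁺ s x p rewrite <ᵇ-false {s} {x} p = s≤s p

bump-above-gt : ∀ t s0 x → t ≤ s0 → (suc s0 < bump t x → s0 < x) × (s0 < x → suc s0 < bump t x)
bump-above-gt t s0 x ts with t <ᵇ x in e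
... | true = (λ p → ≤-pred p) , (λ p → s≤s p)
... | false = (λ p → ⊥-elim (<⇒≱ p (≤-trans (<ᵇ-false⁻ {t} {x} e) (≤-trans ts (n≤1+n s0)))))
            , (λ p → ⊥-elim (<⇒≱ p (≤-trans (<ᵇ-false⁻ {t} {x} e) ts)))

bump-above-le : ∀ t s0 x → t ≤ s0 → (bump t x ≤ suc s0 → x ≤ s0) × (x ≤ s0 → bump t x ≤ suc s0)
bump-above-le t s0 x ts = (λ p → ≮⇒≥ (λ q → <⇒≱ (proj₂ (bump-above-gt t s0 x ts) q) p))
                        , (λ p → ≮⇒≥ (λ q → <⇒≱ (proj₁ (bump-above-gt t s0 x ts) q) p))

bump-below-gt : ∀ t s x → s ≤ t → (s < bump t x → s < x) × (s < x → s < bump t x)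
bump-below-gt t s x st with t <ᵇ x in e
... | true = (λ _ → ≤-trans (s≤s st) (<ᵇ-true⁻ {t} {x} e)) , (λ p → ≤-trans p (n≤1+n x))
... | false = (λ p → p) , (λ p → p)

bump-below-le : ∀ t s x → s ≤ t → (bump t x ≤ s → x ≤ s) × (x ≤ s → bump t x ≤ s)
bump-below-le t s x st = (λ p → ≮⇒≥ (λ q → <⇒≱ (proj₂ (bump-below-gt t s x st) q) p))
                       , (λ p → ≮⇒≥ (λ q → <⇒≱ (proj₁ (bump-below-gt t s x st) q) p))

bump-InRange : ∀ t n x → InRange n x → InRange (suc n) (bump t x)
bump-InRange t n x (p , q) with t <ᵇ x
... | true = s≤s z≤n , s≤s q
... | false = p , ≤-trans q (n≤1+n n)

Increasing-bump : ∀ s U → Increasing U → Increasing (map (bump s) U)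
Increasing-bump s [] _ = tt
Increasing-bump s (x ∷ U) (a , ss) = AllP.map⁺ (AllM.map (bump-<⁺ s) a) , Increasing-bump s U ss

allᵇ-bump : ∀ t x w → allᵇ (_<ᵇ bump t x) (map (bump t) w) ≡ allᵇ (_<ᵇ x) w
allᵇ-bump t x [] = refl
allᵇ-bump t x (y ∷ w) rewrite bump-<ᵇ t y x = cong ((y <ᵇ x) ∧_) (allᵇ-bump t x w)

rlMaxima-bump : ∀ t w → rlMaxima (map (bump t) w) ≡ map (bump t) (rlMaxima w)
rlMaxima-bump t [] = refl
rlMaxima-bump t (x ∷ w) rewrite allᵇ-bump t x w with allᵇ (_<ᵇ x) w
... | true = cong (bump t x ∷_) (rlMaxima-bump t w)
... | false = rlMaxima-bump t w

insertAt-length : ∀ π t → length (insertAt π t) ≡ suc (length π)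
insertAt-length π t = trans (length-++ (map (bump t) π)) (trans (cong (_+ 1) (length-map (bump t) π)) (+-comm (length π) 1))

IsPerm-insertAt : ∀ π t → IsPerm (length π) π → t ≤ length π → IsPerm (length (insertAt π t)) (insertAt π t)
IsPerm-insertAt π t (r , d) tn rewrite insertAt-length π t =
  AllP.++⁺ (AllP.map⁺ (AllM.map (λ {x} q → bump-InRange t (length π) x q) r)) ((s≤s z≤n , s≤s tn) ∷ []) ,
  Distinct-++⁺ (map (bump t) π) (suc t ∷ [])
    (Distinct-map {P = λ _ → ⊤} (bump t) (λ {x} {y} _ _ e → bump-injective t x y e) π (AllM.tabulate (λ _ → tt)) d) ([] , tt)
    (AllP.map⁺ (AllM.tabulate (λ {x} _ → bump-≢ t x ∷ [])))

unbump : ℕ → ℕ → ℕ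
unbump l a = if l <ᵇ a then a ∸ 1 else a

bump∘unbump : ∀ l a → suc l ≢ a → bump l (unbump (suc l) a) ≡ a
bump∘unbump l a l+1≢a with suc l <ᵇ a in l+1<a
bump∘unbump l zero _ | true = ⊥-elim (subst T (sym l+1<a) tt)
bump∘unbump l (suc a) _ | true = bump-shift l a (≤-pred (<ᵇ-true⁻ l+1<a))
bump∘unbump l a l+1≢a | false = bump-fix l a (≤-pred (≤∧≢⇒< (<ᵇ-false⁻ l+1<a) (λ a≡ → l+1≢a (sym a≡))))

unbump-injective : ∀ l {x y} → suc l ≢ x → suc l ≢ y → unbump (suc l) x ≡ unbump (suc l) y → x ≡ y
unbump-injective l {x} {y} l+1≢x l+1≢y e =
  trans (sym (bump∘unbump l x l+1≢x)) (trans (cong (bump l) e) (bump∘unbump l y l+1≢y))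

unbump-InRange : ∀ l m a → InRange (suc m) a → suc l ≢ a → InRange (suc m) (suc l) → InRange m (unbump (suc l) a)
unbump-InRange l m a (1≤a , _) l+1≢a (_ , l+1≤m+1) with suc l <ᵇ a in l+1<a
unbump-InRange l m (suc (suc a)) (_ , s≤s a+1≤m) _ _ | true = s≤s z≤n , a+1≤m
unbump-InRange l m (suc zero) _ _ _ | true = ⊥-elim (<⇒≱ (<ᵇ-true⁻ {suc l} {1} l+1<a) (s≤s z≤n))
... | false = 1≤a , ≤-pred (≤-trans (≤∧≢⇒< (<ᵇ-false⁻ {suc l} {a} l+1<a) (λ a≡l+1 → l+1≢a (sym a≡l+1))) l+1≤m+1)

deleteLast-spec : ∀ π → IsPerm (length π) π → 1 ≤ length π →
  IsPerm (length (deleteLast π)) (deleteLast π) × insertAt (deleteLast π) (lastL π ∸ 1) ≡ π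
deleteLast-spec [] _ ()
deleteLast-spec (x ∷ xs) pm _ with initL (x ∷ xs) | lastL (x ∷ xs) | initL++lastL x xs
... | w | zero | π≡wl = ⊥-elim (no-zero (AllP.++⁻ʳ w (subst (All (InRange (length (x ∷ xs)))) π≡wl (proj₁ pm))))
  where no-zero : All (InRange (length (x ∷ xs))) (zero ∷ []) → ⊥
        no-zero ((() , _) ∷ [])
... | w | suc l | π≡wl = unbumped-perm , reinsert
  where
    n = length (x ∷ xs)
    pm-wl : IsPerm n (w ++ suc l ∷ [])
    pm-wl = subst (IsPerm n) π≡wl pm
    |π|≡ : n ≡ suc (length w)
    |π|≡ = trans (cong length π≡wl) (trans (length-++ w) (+-comm (length w) 1))
    w-range : All (InRange n) w
    w-range = AllP.++⁻ˡ w (proj₁ pm-wl)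
    l-range : InRange n (suc l)
    l-range with AllP.++⁻ʳ w (proj₁ pm-wl)
    ... | q ∷ [] = q
    w-distinct = Distinct-++⁻ w (suc l ∷ []) (proj₂ pm-wl)
    l∉w : All (suc l ≢_) w
    l∉w = AllM.map (λ { (q ∷ []) → λ e → q (sym e) }) (proj₂ (proj₂ w-distinct))
    unbumped-perm : IsPerm (length (map (unbump (suc l)) w)) (map (unbump (suc l)) w)
    unbumped-perm rewrite length-map (unbump (suc l)) w =
      AllP.map⁺ (AllM.map (λ { {a} (r , ne) → unbump-InRange l (length w) a (subst (λ k → InRange k a) |π|≡ r) ne (subst (λ k → InRange k (suc l)) |π|≡ l-range) })
                   (AllM.zip (w-range , l∉w))) ,
      Distinct-map (unbump (suc l)) (unbump-injective l) w l∉w (proj₁ w-distinct)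
    reinsert : map (bump l) (map (unbump (suc l)) w) ++ suc l ∷ [] ≡ x ∷ xs
    reinsert = trans (cong (_++ suc l ∷ []) (trans (sym (map-∘ w)) (trans (map-cong-local (AllM.map (λ {a} ne → bump∘unbump l a ne) l∉w)) (map-id w)))) (sym π≡wl)

-- Write S(π) = E ++ F, where F is the final stack of
-- the machine (the right-to-left maxima) and E is what was output before.
-- Appending t+1 pops the part of F below t+1, so
--   S(π^(t)) = bump(E) ++ lowPart ++ (t+1) ∷ highPart,   lowPart ++ highPart = bump(F).

emitted : List ℕ → List ℕ
emitted π = output [] π

finalStack : List ℕ → List ℕ
finalStack π = stack [] π

lowPart : ℕ → List ℕ → List ℕ
lowPart t F = popped (suc t) (map (bump t) F)

highPart : ℕ → List ℕ → List ℕ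
highPart t F = kept (suc t) (map (bump t) F)

childImage : ℕ → List ℕ → List ℕ → List ℕ
childImage t E F = map (bump t) E ++ lowPart t F ++ suc t ∷ highPart t F

-- Reading π^(t) = bump(π) (t+1) is reading π up to relabelling, then t+1.
emitted-insertAt : ∀ π t → emitted (insertAt π t) ≡ map (bump t) (emitted π) ++ lowPart t (finalStack π)
emitted-insertAt π t = trans (output-∷ʳ [] (map (bump t) π) (suc t))
  (cong₂ (λ a b → a ++ popped (suc t) b) (output-map (bump t) (bump-<ᵇ t) [] π) (stack-map (bump t) (bump-<ᵇ t) [] π))

finalStack-insertAt : ∀ π t → finalStack (insertAt π t) ≡ suc t ∷ highPart t (finalStack π)
finalStack-insertAt π t = trans (stack-∷ʳ [] (map (bump t) π) (suc t))
  (cong (λ b → suc t ∷ kept (suc t) b) (stack-map (bump t) (bump-<ᵇ t) [] π))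

stackSort-insertAt : ∀ π t → stackSort (insertAt π t) ≡ childImage t (emitted π) (finalStack π)
stackSort-insertAt π t = trans (stackSort≡machine (insertAt π t))
  (trans (cong₂ _++_ (emitted-insertAt π t) (finalStack-insertAt π t)) (++-assoc (map (bump t) (emitted π)) _ _))

childImage-assoc : ∀ s N T → childImage s N T ≡ (map (bump s) N ++ lowPart s T) ++ suc s ∷ highPart s T
childImage-assoc s N T = sym (++-assoc (map (bump s) N) (lowPart s T) _)

lowPart++highPart : ∀ s T → lowPart s T ++ highPart s T ≡ map (bump s) T
lowPart++highPart s T = popped++kept (suc s) (map (bump s) T)

childImage-erase : ∀ s N T → (map (bump s) N ++ lowPart s T) ++ highPart s T ≡ map (bump s) (N ++ T)
childImage-erase s N T = trans (++-assoc (map (bump s) N) _ _) (trans (cong (map (bump s) N ++_) (lowPart++highPart s T)) (sym (map-++ (bump s) N T)))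

popped-< : ∀ a U → All (_< a) (popped a U)
popped-< a [] = []
popped-< a (x ∷ U) with x <ᵇ a in e
... | true = <ᵇ-true⁻ e ∷ popped-< a U
... | false = []

kept-≥ : ∀ a U → Increasing U → All (a ≤_) (kept a U) × Increasing (kept a U)
kept-≥ a [] _ = [] , tt
kept-≥ a (x ∷ U) (ax , s) with x <ᵇ a in e
... | true = kept-≥ a U s
... | false = (<ᵇ-false⁻ e ∷ AllM.map (λ q → ≤-trans (<ᵇ-false⁻ e) (<⇒≤ q)) ax) , (ax , s)

popped-++ : ∀ a X Y → All (_< a) X → All (a ≤_) Y → popped a (X ++ Y) ≡ X
popped-++ a [] [] _ _ = refl
popped-++ a [] (y ∷ Y) _ (p ∷ _) rewrite <ᵇ-false {y} {a} p = refl
popped-++ a (x ∷ X) Y (p ∷ ps) q rewrite <ᵇ-true p = cong (x ∷_) (popped-++ a X Y ps q)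

lowPart-≤ : ∀ t T' → All (_≤ t) (lowPart t T')
lowPart-≤ t T' = AllM.map ≤-pred (popped-< (suc t) (map (bump t) T'))

highPart-above : ∀ s T → Increasing T → All (suc s <_) (highPart s T) × Increasing (highPart s T)
highPart-above s T st with kept-≥ (suc s) (map (bump s) T) (Increasing-bump s T st)
... | ge , ss = AllM.map (λ { (p , ne) → ≤∧≢⇒< p (λ e → ne (sym e)) })
                  (AllM.zip (ge , kept-All {P = λ x → x ≢ suc s} (suc s) (map (bump s) T) neq)) , ss
  where
    neq : All (λ x → x ≢ suc s) (map (bump s) T)
    neq = AllP.map⁺ (AllM.tabulate {P = λ x → bump s x ≢ suc s} (λ {x} _ → bump-≢ s x))

-- A site t is blocked by a pair x … y of E forming, together
-- with the new letter t+1, the forbidden pattern; t is active iff it is not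
-- blocked.  (The letters after t+1 lie above it, and F is increasing, so no
-- other occurrence of the pattern can be created.)

-- Blocks c s x y: the letters x, y of E form the forbidden pattern with s+1.
Blocks : Class → ℕ → ℕ → ℕ → Set
Blocks SS s x y = s < x × x < y
Blocks SrS s x y = x ≤ s × s < y

Blocks-site< : ∀ c {s x y} → Blocks c s x y → s < y
Blocks-site< SS (p , q) = <-trans p q
Blocks-site< SrS (p , q) = q

Forbidden-last<middle : ∀ c {x y z} → Forbidden c x y z → z < y
Forbidden-last<middle SS (zx , xy) = <-trans zx xy
Forbidden-last<middle SrS (xz , zy) = zy

Forbidden-bump⁻ : ∀ c s {x y z} → Forbidden c (bump s x) (bump s y) (bump s z) → Forbidden c x y z
Forbidden-bump⁻ SS s (p , q) = bump-<⁻ s p , bump-<⁻ s q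
Forbidden-bump⁻ SrS s (p , q) = bump-<⁻ s p , bump-<⁻ s q

Forbidden-bump⁺ : ∀ c s {x y z} → Forbidden c x y z → Forbidden c (bump s x) (bump s y) (bump s z)
Forbidden-bump⁺ SS s (p , q) = bump-<⁺ s p , bump-<⁺ s q
Forbidden-bump⁺ SrS s (p , q) = bump-<⁺ s p , bump-<⁺ s q

Forbidden⇒Blocks : ∀ c s {x y} → Forbidden c (bump s x) (bump s y) (suc s) → Blocks c s x y
Forbidden⇒Blocks SS s {x} {y} (p , q) = bump-gt⁻ s x p , bump-<⁻ s q
Forbidden⇒Blocks SrS s {x} {y} (p , q) = bump-lt⁻ s x p , bump-gt⁻ s y q

Blocks⇒Forbidden : ∀ c s {x y} → Blocks c s x y → Forbidden c (bump s x) (bump s y) (suc s)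
Blocks⇒Forbidden SS s {x} {y} (p , q) = bump-gt⁺ s x p , bump-<⁺ s q
Blocks⇒Forbidden SrS s {x} {y} (p , q) = bump-le⁺ s x p , bump-gt⁺ s y q

HasPair-increasing : ∀ {Q′} w → Increasing w → HasPair Q′ w → ∃ λ y → ∃ λ z → y < z × Q′ y z
HasPair-increasing (y ∷ w) (a , s) (inj₁ q) with All-Any a q
... | z , yz , qq = y , z , yz , qq
HasPair-increasing (y ∷ w) (a , s) (inj₂ p) = HasPair-increasing w s p

-- An
-- occurrence avoiding t+1 comes from one in S(π) = E ++ F.  The letter t+1
-- is neither its first nor its middle entry, since the letters after t+1 are
-- increasing and above it; as its last entry, the other two entries lie in
-- bump(E) because lowPart is below t+1, and they form a blocking pair.
noBlock⇒avoids : ∀ c s E F → ¬ HasTriple (Forbidden c) (E ++ F) → Increasing F → ¬ HasPair (Blocks c s) E →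
  ¬ HasTriple (Forbidden c) (childImage s E F)
noBlock⇒avoids c s E F noEF F↑ noBlock t
  with HasTriple-insert⁻ (map (bump s) E ++ lowPart s F) (suc s) (highPart s F)
         (subst (HasTriple (Forbidden c)) (childImage-assoc s E F) t)
... | inj₁ t′ = noEF (HasTriple-mono (Forbidden-bump⁻ c s) (E ++ F)
                  (HasTriple-map⁻ (bump s) (E ++ F) (subst (HasTriple (Forbidden c)) (childImage-erase s E F) t′)))
... | inj₂ (inj₁ a-y-z) with HasPair-increasing (highPart s F) (proj₂ (highPart-above s F F↑)) a-y-z
...   | _ , _ , y<z , pat = <-asym y<z (Forbidden-last<middle c pat)
noBlock⇒avoids c s E F noEF F↑ noBlock t | inj₂ (inj₂ (inj₁ x-a-z))
  with All-Any (proj₁ (highPart-above s F F↑)) (proj₂ (AnyM.satisfied x-a-z))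
...   | _ , a<z , pat = <-asym a<z (Forbidden-last<middle c pat)
noBlock⇒avoids c s E F noEF F↑ noBlock t | inj₂ (inj₂ (inj₂ x-y-a))
  with HasPair-++⁻ (map (bump s) E) (lowPart s F) x-y-a
...   | inj₁ in-E = noBlock (HasPair-mono (Forbidden⇒Blocks c s) E (HasPair-map⁻ (bump s) E in-E))
...   | inj₂ (inj₁ in-low) with All-Any (popped-< (suc s) (map (bump s) F)) (HasPair-second (lowPart s F) in-low)
...     | _ , y<a , _ , pat = <-asym y<a (Forbidden-last<middle c pat)
noBlock⇒avoids c s E F noEF F↑ noBlock t | inj₂ (inj₂ (inj₂ x-y-a)) | inj₂ (inj₂ x-low)
  with All-Any (popped-< (suc s) (map (bump s) F)) (proj₂ (AnyM.satisfied x-low))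
...     | _ , y<a , pat = <-asym y<a (Forbidden-last<middle c pat)

block⇒forbidden : ∀ c s N T → HasPair (Blocks c s) N → HasTriple (Forbidden c) (childImage s N T)
block⇒forbidden c s N T p = HasTriple-++ᵇ (map (bump s) N) (lowPart s T ++ suc s ∷ highPart s T)
  (HasPair-map⁺ {Q = λ u v → Any (Forbidden c u v) (lowPart s T ++ suc s ∷ highPart s T)} (bump s) N
     (HasPair-mono (λ q → AnyP.++⁺ʳ (lowPart s T) (here (Blocks⇒Forbidden c s q))) N p))

active : Class → List ℕ → ℕ → Bool
active c π s = inCᵇ c (insertAt π s)

memberFacts : ∀ c π → InC c π →
  IsPerm (length π) π × ¬ HasTriple (Forbidden c) (emitted π ++ finalStack π) × Increasing (finalStack π) × finalStack π ≡ reverse (rlMaxima π)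
memberFacts c π ic with InC⇒avoidance c π ic
... | pm , nt = pm , (λ t → nt (subst (HasTriple (Forbidden c)) (sym (stackSort≡machine π)) t)) ,
                proj₂ (stack≡rlMaxima π (proj₂ pm)) , proj₁ (stack≡rlMaxima π (proj₂ pm))

active⇒noBlock : ∀ c π s → InC c π → T (active c π s) → ¬ HasPair (Blocks c s) (emitted π)
active⇒noBlock c π s ic a p with InC⇒avoidance c (insertAt π s) a
... | _ , nt = nt (subst (HasTriple (Forbidden c)) (sym (stackSort-insertAt π s)) (block⇒forbidden c s (emitted π) (finalStack π) p))

noBlock⇒active : ∀ c π s → InC c π → s ≤ length π → ¬ HasPair (Blocks c s) (emitted π) → T (active c π s)
noBlock⇒active c π s ic sn np with memberFacts c π ic
... | pm , nt , st , _ = avoidance⇒InC c (insertAt π s) (IsPerm-insertAt π s pm sn)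
      (λ t → noBlock⇒avoids c s (emitted π) (finalStack π) nt st np (subst (HasTriple (Forbidden c)) (stackSort-insertAt π s) t))

Distinct-stackSort : ∀ c π → InC c π → Distinct (emitted π ++ finalStack π)
Distinct-stackSort c π ic = subst Distinct (stackSort≡machine π) (Distinct-resp-↭ (↭-sym (stackSort↭ π)) (proj₂ (proj₁ (InC⇒avoidance c π ic))))

-- Closure under deleting the last letter: π is the child of its deletion at
-- site (last letter - 1), and erasing a letter of S(π) keeps pattern avoidance.

deleteLast-closed : ∀ c π → InC c π → 2 ≤ length π → InC c (deleteLast π)
deleteLast-closed c π ic |π|≥2 with deleteLast-spec π (proj₁ (InC⇒avoidance c π ic)) (≤-trans (s≤s z≤n) |π|≥2)
... | pm , reinsert = avoidance⇒InC c π′ pm noPattern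
  where
    π′ = deleteLast π
    s = lastL π ∸ 1
    E = emitted π′
    F = finalStack π′
    S[π]≡ : (map (bump s) E ++ lowPart s F) ++ suc s ∷ highPart s F ≡ stackSort π
    S[π]≡ = trans (sym (childImage-assoc s E F)) (trans (sym (stackSort-insertAt π′ s)) (cong stackSort reinsert))
    noPattern : ¬ HasTriple (Forbidden c) (stackSort π′)
    noPattern t = proj₂ (InC⇒avoidance c π ic) (subst (HasTriple (Forbidden c)) S[π]≡
      (HasTriple-insert (map (bump s) E ++ lowPart s F) (suc s) (highPart s F)
        (subst (HasTriple (Forbidden c)) (sym (childImage-erase s E F))
          (HasTriple-map⁺ (bump s) (E ++ F) (HasTriple-mono (Forbidden-bump⁺ c s) (E ++ F)
            (subst (HasTriple (Forbidden c)) (stackSort≡machine π′) t))))))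

-- Its emitted part is bump(E) ++ lowPart, so a
-- site s ≥ t of π corresponds to the site s+1 of the child, and a site s ≤ t
-- lying above lowPart is active in the child iff it is active in π.

HasPair-dropLow : ∀ c s M L → All (_≤ s) L → HasPair (Blocks c s) (M ++ L) → HasPair (Blocks c s) M
HasPair-dropLow c s M L L≤s blocking with HasPair-++⁻ M L blocking
... | inj₁ pair = pair
... | inj₂ (inj₁ pair) with All-Any L≤s (HasPair-second L pair)
...   | y , y≤s , x , blocks = ⊥-elim (<⇒≱ (Blocks-site< c blocks) y≤s)
HasPair-dropLow c s M L L≤s blocking | inj₂ (inj₂ pair) with AnyM.satisfied pair
... | x , in-L with All-Any L≤s in-L
...   | y , y≤s , blocks = ⊥-elim (<⇒≱ (Blocks-site< c blocks) y≤s)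

Blocks-bumpAbove⁻ : ∀ c t s0 {x y} → t ≤ s0 → Blocks c (suc s0) (bump t x) (bump t y) → Blocks c s0 x y
Blocks-bumpAbove⁻ SS t s0 {x} {y} ts (p , q) = proj₁ (bump-above-gt t s0 x ts) p , bump-<⁻ t q
Blocks-bumpAbove⁻ SrS t s0 {x} {y} ts (p , q) = proj₁ (bump-above-le t s0 x ts) p , proj₁ (bump-above-gt t s0 y ts) q

Blocks-bumpAbove⁺ : ∀ c t s0 {x y} → t ≤ s0 → Blocks c s0 x y → Blocks c (suc s0) (bump t x) (bump t y)
Blocks-bumpAbove⁺ SS t s0 {x} {y} ts (p , q) = proj₂ (bump-above-gt t s0 x ts) p , bump-<⁺ t q
Blocks-bumpAbove⁺ SrS t s0 {x} {y} ts (p , q) = proj₂ (bump-above-le t s0 x ts) p , proj₂ (bump-above-gt t s0 y ts) q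

Blocks-bumpBelow⁻ : ∀ c t s {x y} → s ≤ t → Blocks c s (bump t x) (bump t y) → Blocks c s x y
Blocks-bumpBelow⁻ SS t s {x} {y} st (p , q) = proj₁ (bump-below-gt t s x st) p , bump-<⁻ t q
Blocks-bumpBelow⁻ SrS t s {x} {y} st (p , q) = proj₁ (bump-below-le t s x st) p , proj₁ (bump-below-gt t s y st) q

Blocks-bumpBelow⁺ : ∀ c t s {x y} → s ≤ t → Blocks c s x y → Blocks c s (bump t x) (bump t y)
Blocks-bumpBelow⁺ SS t s {x} {y} st (p , q) = proj₂ (bump-below-gt t s x st) p , bump-<⁺ t q
Blocks-bumpBelow⁺ SrS t s {x} {y} st (p , q) = proj₂ (bump-below-le t s x st) p , proj₂ (bump-below-gt t s y st) q

module ChildSites (c : Class) (π : List ℕ) (t : ℕ) (π∈C : InC c π) (t≤n : t ≤ length π) (t-active : T (active c π t)) where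
  π′ = insertAt π t
  n = length π
  E = emitted π
  low = lowPart t (finalStack π)
  bumpE = map (bump t) E

  length-child : length π′ ≡ suc n
  length-child = insertAt-length π t

  emitted-child : emitted π′ ≡ bumpE ++ low
  emitted-child = emitted-insertAt π t

  active⇒noBlock′ : ∀ s → T (active c π′ s) → ¬ HasPair (Blocks c s) (bumpE ++ low)
  active⇒noBlock′ s a p = active⇒noBlock c π′ s t-active a (subst (HasPair (Blocks c s)) (sym emitted-child) p)

  noBlock⇒active′ : ∀ s → s ≤ suc n → ¬ HasPair (Blocks c s) (bumpE ++ low) → T (active c π′ s)
  noBlock⇒active′ s s≤n np = noBlock⇒active c π′ s t-active (≤-trans s≤n (≤-reflexive (sym length-child)))
    (λ p → np (subst (HasPair (Blocks c s)) emitted-child p))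

  active-shift : ∀ s → t ≤ s → s ≤ n → active c π′ (suc s) ≡ active c π s
  active-shift s t≤s s≤n = T-ext f g
    where
      f : T (active c π′ (suc s)) → T (active c π s)
      f a = noBlock⇒active c π s π∈C s≤n (λ p → active⇒noBlock′ (suc s) a
              (HasPair-++ˡ bumpE low (HasPair-map⁺ {Q = Blocks c (suc s)} (bump t) E (HasPair-mono (Blocks-bumpAbove⁺ c t s t≤s) E p))))
      g : T (active c π s) → T (active c π′ (suc s))
      g a = noBlock⇒active′ (suc s) (s≤s s≤n) (λ p → active⇒noBlock c π s π∈C a
              (HasPair-mono (Blocks-bumpAbove⁻ c t s t≤s) E (HasPair-map⁻ (bump t) E
                 (HasPair-dropLow c (suc s) bumpE low (AllM.map (λ q → ≤-trans q (≤-trans t≤s (n≤1+n s))) (lowPart-≤ t (finalStack π))) p))))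

  active-low : ∀ s → s ≤ t → All (_≤ s) low → active c π′ s ≡ active c π s
  active-low s s≤t low≤s = T-ext f g
    where
      f : T (active c π′ s) → T (active c π s)
      f a = noBlock⇒active c π s π∈C (≤-trans s≤t t≤n) (λ p → active⇒noBlock′ s a
              (HasPair-++ˡ bumpE low (HasPair-map⁺ {Q = Blocks c s} (bump t) E (HasPair-mono (Blocks-bumpBelow⁺ c t s s≤t) E p))))
      g : T (active c π s) → T (active c π′ s)
      g a = noBlock⇒active′ s (≤-trans s≤t (≤-trans t≤n (n≤1+n n))) (λ p → active⇒noBlock c π s π∈C a
              (HasPair-mono (Blocks-bumpBelow⁻ c t s s≤t) E (HasPair-map⁻ (bump t) E (HasPair-dropLow c s bumpE low low≤s p))))

  stackSort-child : stackSort π′ ≡ (bumpE ++ low) ++ suc t ∷ highPart t (finalStack π)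
  stackSort-child = trans (stackSort≡machine π′) (cong₂ _++_ emitted-child (finalStack-insertAt π t))

  factsπ = memberFacts c π π∈C

  highPart-gt : All (suc t <_) (highPart t (finalStack π))
  highPart-gt = proj₁ (highPart-above t (finalStack π) (proj₁ (proj₂ (proj₂ factsπ))))

  small∈emitted : ∀ u → u ≤ t → 1 ≤ u → Any (_≡ u) (bumpE ++ low)
  small∈emitted u u≤t 1≤u with AnyP.++⁻ (bumpE ++ low) (subst (Any (_≡ u)) stackSort-child
    (∈stackSort c π′ t-active u (1≤u , ≤-trans u≤t (≤-trans t≤n (≤-trans (n≤1+n n) (≤-reflexive (sym length-child)))))))
  ... | inj₁ a = a
  ... | inj₂ (here e) = ⊥-elim (<-irrefl (sym e) (s≤s u≤t))
  ... | inj₂ (there a) with All-Any highPart-gt a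
  ...   | z , tz , e = ⊥-elim (<⇒≱ (≤-trans (n≤1+n (suc t)) tz) (subst (_≤ t) (sym e) u≤t))

  emitted-positive : All (1 ≤_) (bumpE ++ low)
  emitted-positive = AllP.++⁻ˡ (bumpE ++ low) (subst (All (1 ≤_)) stackSort-child
          (PermP.All-resp-↭ (↭-sym (stackSort↭ π′)) (AllM.map proj₁ (proj₁ (proj₁ (InC⇒avoidance c π′ t-active))))))

  blocked-site : ∀ low′ v s w → low ≡ low′ ++ v ∷ [] → w ≤ t → 1 ≤ w → w ≢ v → Blocks c s w v → active c π′ s ≡ false
  blocked-site low′ v s w low≡ w≤t 1≤w w≢v q = ¬T⇒false (λ a → active⇒noBlock′ s a (subst (HasPair (Blocks c s)) low≡′ blocking))
    where
      low≡′ : (bumpE ++ low′) ++ v ∷ [] ≡ bumpE ++ low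
      low≡′ = trans (++-assoc bumpE low′ (v ∷ [])) (cong (bumpE ++_) (sym low≡))
      w∈ : Any (_≡ w) (bumpE ++ low′)
      w∈ with AnyP.++⁻ (bumpE ++ low′) (subst (Any (_≡ w)) (sym low≡′) (small∈emitted w w≤t 1≤w))
      ... | inj₁ a = a
      ... | inj₂ (here e) = ⊥-elim (w≢v (sym e))
      blocking : HasPair (Blocks c s) ((bumpE ++ low′) ++ v ∷ [])
      blocking = HasPair-++ᵐ (bumpE ++ low′) (v ∷ []) (AnyM.map (λ { refl → here q }) w∈)

pred<⇒≤ : ∀ {v x} → 1 ≤ v → v ∸ 1 < x → v ≤ x
pred<⇒≤ {suc v} _ p = p

SS-site-active : ∀ π t (π∈C : InC SS π) (t≤n : t ≤ length π) (t-active : T (active SS π t)) low′ v →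
  lowPart t (finalStack π) ≡ low′ ++ v ∷ [] → All (_≤ v) low′ → v ≤ t → Any (_≡ v) (finalStack π) → 1 ≤ v →
  active SS (insertAt π t) (v ∸ 1) ≡ true
SS-site-active π t π∈C t≤n t-active low′ v low≡ low′≤v v≤t v∈F 1≤v =
  T⇒true (noBlock⇒active′ (v ∸ 1) (≤-trans (m∸n≤m v 1) (≤-trans v≤t (≤-trans t≤n (n≤1+n _)))) noBlock)
  where
    open ChildSites SS π t π∈C t≤n t-active
    F = finalStack π
    low≤v : All (_≤ v) low
    low≤v = subst (All (_≤ v)) (sym low≡) (AllP.++⁺ low′≤v (≤-refl ∷ []))
    E∉F = proj₂ (proj₂ (Distinct-++⁻ E F (Distinct-stackSort SS π π∈C)))
    E≢v : All (_≢ v) E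
    E≢v = AllM.map (λ {x} ax → nv x ax) E∉F
      where
        nv : ∀ x → All (x ≢_) F → x ≢ v
        nv x ax e with All-Any ax v∈F
        ... | z , xz , zv = xz (trans e (sym zv))
    noPattern = proj₁ (proj₂ factsπ)
    -- a blocking pair x < y with v ≤ x lies in bump(E) (low is at most v), and
    -- then x y v would be a 231 in S(π), as v ∈ F comes after E and x ≠ v
    noBlock : ¬ HasPair (Blocks SS (v ∸ 1)) (bumpE ++ low)
    noBlock p with HasPair-++⁻ bumpE low p
    ... | inj₁ pM = noPattern (HasTriple-++ᵇ E F (HasPair-monoᴬ E E≢v
            (λ { {x} {y} xnv (q1 , q2) → AnyM.map (λ { refl → ≤∧≢⇒< (pred<⇒≤ 1≤v q1) (λ e → xnv (sym e)) , q2 }) v∈F })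
            (HasPair-mono (Blocks-bumpBelow⁻ SS t (v ∸ 1) (≤-trans (m∸n≤m v 1) v≤t)) E (HasPair-map⁻ (bump t) E pM))))
    ... | inj₂ (inj₁ pL) with All-Any low≤v (HasPair-second low pL)
    ...   | y , yv , x , (q1 , q2) = <⇒≱ (≤-trans (s≤s (pred<⇒≤ 1≤v q1)) q2) yv
    noBlock p | inj₂ (inj₂ cr) with AnyM.satisfied cr
    ... | x , an with All-Any low≤v an
    ...   | y , yv , (q1 , q2) = <⇒≱ (≤-trans (s≤s (pred<⇒≤ 1≤v q1)) q2) yv

SrS-site0-active : ∀ π t (π∈C : InC SrS π) (t≤n : t ≤ length π) (t-active : T (active SrS π t)) → active SrS (insertAt π t) 0 ≡ true
SrS-site0-active π t π∈C t≤n t-active = T⇒true (noBlock⇒active′ 0 z≤n noBlock)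
  where
    open ChildSites SrS π t π∈C t≤n t-active
    noBlock : ¬ HasPair (Blocks SrS 0) (bumpE ++ low)
    noBlock p with All-Any emitted-positive (HasPair-first (bumpE ++ low) p)
    ... | x , x1 , y , (x0 , _) = <⇒≱ x1 x0

indicator : Bool → ℕ
indicator b = if b then 1 else 0

count : (ℕ → Bool) → ℕ → ℕ → ℕ
count a lo zero = 0
count a lo (suc d) = indicator (a lo) + count a (suc lo) d

OnInterval : (ℕ → Set) → ℕ → ℕ → Set
OnInterval P lo d = ∀ s → lo ≤ s → s < lo + d → P s

OnInterval-head : ∀ {P lo d} → OnInterval P lo (suc d) → P lo
OnInterval-head {lo = lo} h = h lo ≤-refl (m<m+n lo z<s)

OnInterval-tail : ∀ {P lo d} → OnInterval P lo (suc d) → OnInterval P (suc lo) d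
OnInterval-tail {lo = lo} {d} h s lo<s s<hi = h s (≤-trans (n≤1+n lo) lo<s) (≤-trans s<hi (≤-reflexive (sym (+-suc lo d))))

count-+ : ∀ a lo d1 d2 → count a lo (d1 + d2) ≡ count a lo d1 + count a (lo + d1) d2
count-+ a lo zero d2 = cong (λ z → count a z d2) (sym (+-identityʳ lo))
count-+ a lo (suc d1) d2 =
  trans (cong (indicator (a lo) +_) (trans (count-+ a (suc lo) d1 d2) (cong (λ z → count a (suc lo) d1 + count a z d2) (sym (+-suc lo d1)))))
        (sym (+-assoc (indicator (a lo)) _ _))

count-splitAt : ∀ a lo mid hi → lo ≤ mid → mid ≤ hi → count a lo (hi ∸ lo) ≡ count a lo (mid ∸ lo) + count a mid (hi ∸ mid)
count-splitAt a lo mid hi lo≤mid mid≤hi =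
  trans (cong (count a lo) (sym lengths)) (trans (count-+ a lo (mid ∸ lo) (hi ∸ mid))
    (cong (λ z → count a lo (mid ∸ lo) + count a z (hi ∸ mid)) (m+[n∸m]≡n lo≤mid)))
  where
    lengths : (mid ∸ lo) + (hi ∸ mid) ≡ hi ∸ lo
    lengths = trans (sym (+-∸-comm (hi ∸ mid) lo≤mid)) (cong (_∸ lo) (trans (+-comm mid (hi ∸ mid)) (m∸n+n≡m mid≤hi)))

count-cong : ∀ a b lo d → OnInterval (λ s → a s ≡ b s) lo d → count a lo d ≡ count b lo d
count-cong a b lo zero h = refl
count-cong a b lo (suc d) h = cong₂ _+_ (cong indicator (OnInterval-head h)) (count-cong a b (suc lo) d (OnInterval-tail h))

count-shift : ∀ a b lo d → OnInterval (λ s → b (suc s) ≡ a s) lo d → count b (suc lo) d ≡ count a lo d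
count-shift a b lo zero h = refl
count-shift a b lo (suc d) h = cong₂ _+_ (cong indicator (OnInterval-head h)) (count-shift a b (suc lo) d (OnInterval-tail h))

count-none : ∀ a lo d → OnInterval (λ s → a s ≡ false) lo d → count a lo d ≡ 0
count-none a lo zero h = refl
count-none a lo (suc d) h rewrite OnInterval-head h = count-none a (suc lo) d (OnInterval-tail h)

count-one : ∀ a lo → count a lo 1 ≡ indicator (a lo)
count-one a lo = +-identityʳ _

countFrom : (ℕ → Bool) → ℕ → ℕ → ℕ
countFrom a M v = count a v (M ∸ v)

length-select-interval : ∀ a lo d → length (select a (applyUpTo (lo +_) d)) ≡ count a lo d
length-select-interval a lo zero = refl
length-select-interval a lo (suc d)
  rewrite +-identityʳ lo | applyUpTo-cong (λ i → lo + suc i) (suc lo +_) d (+-suc lo) with a lo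
... | true = cong suc (length-select-interval a (suc lo) d)
... | false = length-select-interval a (suc lo) d

select-select : ∀ p q xs → select p (select q xs) ≡ select (λ x → p x ∧ q x) xs
select-select p q [] = refl
select-select p q (x ∷ xs) with q x
... | true with p x
...   | true = cong (x ∷_) (select-select p q xs)
...   | false = select-select p q xs
select-select p q (x ∷ xs) | false with p x
...   | true = select-select p q xs
...   | false = select-select p q xs

count-above : ∀ a v m → count (λ s → (v ≤ᵇ s) ∧ a s) 0 m ≡ count a v (m ∸ v)
count-above a v m with v ≤? m
... | yes v≤m = begin
    count a≥v 0 m
  ≡⟨ count-splitAt a≥v 0 v m z≤n v≤m ⟩
    count a≥v 0 v + count a≥v v (m ∸ v)
  ≡⟨ cong₂ _+_ (count-none a≥v 0 v (λ s _ s<v → cong (_∧ a s) (≤ᵇ-false s<v)))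
               (count-cong a≥v a v (m ∸ v) (λ s v≤s _ → cong (_∧ a s) (≤ᵇ-true v≤s))) ⟩
    count a v (m ∸ v)
  ∎
  where
    open ≡-Reasoning
    a≥v = λ s → (v ≤ᵇ s) ∧ a s
... | no v≰m = trans (count-none _ 0 m (λ s _ s<m → cong (_∧ a s) (≤ᵇ-false (<-≤-trans s<m (<⇒≤ (≰⇒> v≰m))))))
                     (cong (count a v) (sym (m≤n⇒m∸n≡0 (<⇒≤ (≰⇒> v≰m)))))

length-activeSites : ∀ a m → length (filterᵇ a (upTo m)) ≡ count a 0 m
length-activeSites a m = trans (cong length (filterᵇ≡select a (upTo m))) (length-select-interval a 0 m)

length-sitesAbove : ∀ a v m → length (filterᵇ (v ≤ᵇ_) (filterᵇ a (upTo m))) ≡ count a v (m ∸ v)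
length-sitesAbove a v m = begin
    length (filterᵇ (v ≤ᵇ_) (filterᵇ a (upTo m)))
  ≡⟨ cong length (trans (filterᵇ≡select (v ≤ᵇ_) (filterᵇ a (upTo m))) (cong (select (v ≤ᵇ_)) (filterᵇ≡select a (upTo m)))) ⟩
    length (select (v ≤ᵇ_) (select a (upTo m)))
  ≡⟨ cong length (select-select (v ≤ᵇ_) a (upTo m)) ⟩
    length (select (λ s → (v ≤ᵇ s) ∧ a s) (upTo m))
  ≡⟨ length-select-interval _ 0 m ⟩
    count (λ s → (v ≤ᵇ s) ∧ a s) 0 m
  ≡⟨ count-above a v m ⟩
    count a v (m ∸ v)
  ∎
  where open ≡-Reasoning

label≡counts : ∀ c π → label c π ≡ (count (active c π) 0 (suc (length π)) , length (rlMaxima π) , map (countFrom (active c π) (suc (length π))) (rlMaxima π))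
label≡counts c π = cong₂ _,_ (length-activeSites (active c π) (suc (length π)))
  (cong (length (rlMaxima π) ,_) (map-cong (λ v → length-sitesAbove (active c π) v (suc (length π))) (rlMaxima π)))

Label-≡ : ∀ {x x′ k k′ : ℕ} {ps ps′ : List ℕ} → x ≡ x′ → k ≡ k′ → ps ≡ ps′ → (x , k , ps) ≡ (x′ , k′ , ps′)
Label-≡ refl refl refl = refl

-- Split the right-to-left maxima of π as
-- V1 ++ V2 with V1 above t and V2 at most t.  The maxima of π′ are bump(V1)
-- followed by t+1, the popped part low is V2 read upwards, and above t the
-- active sites of π′ are those of π shifted by one.  Write C v = p(v) for the
-- number of active sites of π at or above v, and C′ for π′.
module ChildLabel (c : Class) (π : List ℕ) (t : ℕ) (π∈C : InC c π) (t≤n : t ≤ length π) (t-active : T (active c π t))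
                  (V1 V2 : List ℕ) (rl≡ : rlMaxima π ≡ V1 ++ V2) (V1>t : All (t <_) V1) (V2≤t : All (_≤ t) V2) where
  open ChildSites c π t π∈C t≤n t-active
  a = active c π
  a′ = active c π′
  C = countFrom a (suc n)
  C′ = countFrom a′ (suc (suc n))

  F≡ : finalStack π ≡ reverse V2 ++ reverse V1
  F≡ = trans (proj₂ (proj₂ (proj₂ factsπ))) (trans (cong reverse rl≡) (reverse-++ V1 V2))

  low≡ : low ≡ reverse V2
  low≡ = begin
      popped (suc t) (map (bump t) (finalStack π))
    ≡⟨ cong (λ F → popped (suc t) (map (bump t) F)) F≡ ⟩
      popped (suc t) (map (bump t) (reverse V2 ++ reverse V1))
    ≡⟨ cong (popped (suc t)) (map-++ (bump t) (reverse V2) (reverse V1)) ⟩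
      popped (suc t) (map (bump t) (reverse V2) ++ map (bump t) (reverse V1))
    ≡⟨ cong (λ z → popped (suc t) (z ++ map (bump t) (reverse V1))) bumpV2≡V2 ⟩
      popped (suc t) (reverse V2 ++ map (bump t) (reverse V1))
    ≡⟨ popped-++ (suc t) (reverse V2) _ (AllM.map s≤s V2≤t′)
         (AllP.map⁺ (AllM.map (λ {x} t<x → <⇒≤ (bump-gt⁺ t x t<x)) (All-reverse V1 V1>t))) ⟩
      reverse V2
    ∎
    where
      open ≡-Reasoning
      V2≤t′ = All-reverse V2 V2≤t
      bumpV2≡V2 : map (bump t) (reverse V2) ≡ reverse V2
      bumpV2≡V2 = trans (map-cong-local (AllM.map (λ {x} → bump-fix t x) V2≤t′)) (map-id (reverse V2))

  rlMaxima-child : rlMaxima π′ ≡ map (bump t) V1 ++ suc t ∷ []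
  rlMaxima-child = begin
      rlMaxima (map (bump t) π ++ suc t ∷ [])
    ≡⟨ rlMaxima-∷ʳ (map (bump t) π) (suc t) ⟩
      select (suc t <ᵇ_) (rlMaxima (map (bump t) π)) ++ suc t ∷ []
    ≡⟨ cong (λ z → select (suc t <ᵇ_) z ++ suc t ∷ []) (trans (rlMaxima-bump t π) (trans (cong (map (bump t)) rl≡) (map-++ (bump t) V1 V2))) ⟩
      select (suc t <ᵇ_) (map (bump t) V1 ++ map (bump t) V2) ++ suc t ∷ []
    ≡⟨ cong (_++ suc t ∷ []) (select-++ (suc t <ᵇ_) (map (bump t) V1) (map (bump t) V2)) ⟩
      (select (suc t <ᵇ_) (map (bump t) V1) ++ select (suc t <ᵇ_) (map (bump t) V2)) ++ suc t ∷ []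
    ≡⟨ cong₂ (λ u w → (u ++ w) ++ suc t ∷ []) (select-all _ _ above) (select-none _ _ below) ⟩
      (map (bump t) V1 ++ []) ++ suc t ∷ []
    ≡⟨ cong (_++ suc t ∷ []) (++-identityʳ _) ⟩
      map (bump t) V1 ++ suc t ∷ []
    ∎
    where
      open ≡-Reasoning
      above : All (λ x → T (suc t <ᵇ x)) (map (bump t) V1)
      above = AllP.map⁺ (AllM.map (λ {x} t<x → <⇒<ᵇ (bump-gt⁺ t x t<x)) V1>t)
      below : All (λ x → (suc t <ᵇ x) ≡ false) (map (bump t) V2)
      below = AllP.map⁺ (AllM.map (λ {x} x≤t → <ᵇ-false (<⇒≤ (bump-le⁺ t x x≤t))) V2≤t)

  length-rlMaxima-child : length (rlMaxima π′) ≡ suc (length V1)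
  length-rlMaxima-child = trans (cong length rlMaxima-child)
    (trans (length-++ (map (bump t) V1)) (trans (cong (_+ 1) (length-map (bump t) V1)) (+-comm (length V1) 1)))

  C′-shift : ∀ u → t ≤ u → u ≤ n → C′ (suc u) ≡ C u
  C′-shift u t≤u u≤n = count-shift a a′ u (suc n ∸ u) (λ s u≤s s<hi → active-shift s (≤-trans t≤u u≤s)
                         (≤-pred (≤-trans s<hi (≤-reflexive (m+[n∸m]≡n (≤-trans u≤n (n≤1+n n)))))))

  maxima-counts : map C′ (rlMaxima π′) ≡ map C V1 ++ C t ∷ []
  maxima-counts = begin
      map C′ (rlMaxima π′)
    ≡⟨ cong (map C′) rlMaxima-child ⟩
      map C′ (map (bump t) V1 ++ suc t ∷ [])
    ≡⟨ map-++ C′ (map (bump t) V1) (suc t ∷ []) ⟩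
      map C′ (map (bump t) V1) ++ C′ (suc t) ∷ []
    ≡⟨ cong₂ (λ u w → u ++ w ∷ []) (trans (sym (map-∘ V1)) (map-cong-local (AllM.zipWith shifted (V1>t , V1≤n))))
             (C′-shift t ≤-refl t≤n) ⟩
      map C V1 ++ C t ∷ []
    ∎
    where
      open ≡-Reasoning
      V1≤n : All (_≤ n) V1
      V1≤n = AllM.map proj₂ (AllP.++⁻ˡ V1 (subst (All (InRange n)) rl≡ (rlMaxima-All π (proj₁ (proj₁ factsπ)))))
      shifted : ∀ {x} → t < x × x ≤ n → C′ (bump t x) ≡ C x
      shifted {x} (t<x , x≤n) = trans (cong C′ (bump-shift t x t<x)) (C′-shift x (<⇒≤ t<x) x≤n)

  label-shape : ∀ X → C′ 0 ≡ X → label c π′ ≡ (X , suc (length V1) , map C V1 ++ C t ∷ [])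
  label-shape X C′0≡X = trans (label≡counts c π′) (Label-≡ (trans (cong (λ m → count a′ 0 (suc m)) length-child) C′0≡X)
    length-rlMaxima-child (trans (cong (λ m → map (countFrom a′ (suc m)) (rlMaxima π′)) length-child) maxima-counts))

  C′0-split : C′ 0 ≡ count a′ 0 (suc t) + C t
  C′0-split = trans (count-splitAt a′ 0 (suc t) (suc (suc n)) z≤n (s≤s (≤-trans t≤n (n≤1+n n))))
                    (cong (count a′ 0 (suc t) +_) (C′-shift t ≤-refl t≤n))

  -- The site t itself is active in π.
  count-through-t : ∀ lo → lo ≤ t → count a lo (suc t ∸ lo) ≡ count a lo (t ∸ lo) + 1
  count-through-t lo lo≤t = trans (count-splitAt a lo t (suc t) lo≤t (n≤1+n t))
    (cong (count a lo (t ∸ lo) +_) (trans (cong (count a t) (trans (+-∸-assoc 1 {t} ≤-refl) (cong suc (n∸n≡0 t))))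
      (trans (count-one a t) (cong indicator (T⇒true t-active)))))

  C-split : ∀ v → v ≤ t → C v ≡ count a v (t ∸ v) + C t
  C-split v v≤t = count-splitAt a v t (suc n) v≤t (≤-trans t≤n (n≤1+n n))

  count-low : ∀ v → v ≤ t → All (_≤ v) low → count a′ v (suc t ∸ v) ≡ count a v (suc t ∸ v)
  count-low v v≤t low≤v = count-cong a′ a v (suc t ∸ v) (λ s v≤s s<hi →
    active-low s (≤-pred (≤-trans s<hi (≤-reflexive (m+[n∸m]≡n (≤-trans v≤t (n≤1+n t)))))) (AllM.map (λ q → ≤-trans q v≤s) low≤v))

  label-newMaximum : V2 ≡ [] → label c π′ ≡ (suc (C 0) , suc (length V1) , map C V1 ++ C t ∷ [])
  label-newMaximum V2≡[] = label-shape (suc (C 0)) (begin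
      C′ 0
    ≡⟨ C′0-split ⟩
      count a′ 0 (suc t) + C t
    ≡⟨ cong (_+ C t) (count-low 0 z≤n (subst (All (_≤ 0)) (sym (trans low≡ (cong reverse V2≡[]))) [])) ⟩
      count a 0 (suc t) + C t
    ≡⟨ cong (_+ C t) (count-through-t 0 z≤n) ⟩
      (count a 0 t + 1) + C t
    ≡⟨ trans (+-assoc (count a 0 t) 1 (C t)) (+-suc (count a 0 t) (C t)) ⟩
      suc (count a 0 t + C t)
    ≡⟨ cong suc (sym (C-split 0 z≤n)) ⟩
      suc (C 0)
    ∎)
    where open ≡-Reasoning

  lowerMaxima-facts : ∀ v V2′ → V2 ≡ v ∷ V2′ →
    (low ≡ reverse V2′ ++ v ∷ []) × All (_≤ v) (reverse V2′) × v ≤ t × Any (_≡ v) (finalStack π) × 1 ≤ v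
  lowerMaxima-facts v V2′ V2≡ = low≡v , V2′≤v , AllM.head (subst (All (_≤ t)) V2≡ V2≤t) , v∈F , 1≤v
    where
      low≡v : low ≡ reverse V2′ ++ v ∷ []
      low≡v = trans low≡ (trans (cong reverse V2≡) (unfold-reverse v V2′))
      low↑ : Increasing (reverse V2′ ++ v ∷ [])
      low↑ = subst Increasing low≡v (proj₁ (Increasing-++⁻ low (reverse V1)
               (subst Increasing (trans F≡ (cong (_++ reverse V1) (sym low≡))) (proj₁ (proj₂ (proj₂ factsπ))))))
      V2′≤v : All (_≤ v) (reverse V2′)
      V2′≤v = AllM.map (λ { (p ∷ []) → <⇒≤ p }) (proj₂ (proj₂ (Increasing-++⁻ (reverse V2′) (v ∷ []) low↑)))
      v∈F : Any (_≡ v) (finalStack π)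
      v∈F = subst (Any (_≡ v)) (sym (trans F≡ (cong (_++ reverse V1) (trans (cong reverse V2≡) (unfold-reverse v V2′)))))
              (AnyP.++⁺ˡ (AnyP.++⁺ʳ (reverse V2′) (here refl)))
      1≤v : 1 ≤ v
      1≤v = proj₁ (AllM.head (AllP.++⁻ʳ V1 (subst (All (InRange n)) (trans rl≡ (cong (V1 ++_) V2≡)) (rlMaxima-All π (proj₁ (proj₁ factsπ))))))

  label-oldMaximum : ∀ v V2′ → V2 ≡ v ∷ V2′ → count a′ 0 v ≡ 1 →
    label c π′ ≡ (suc (suc (C v)) , suc (length V1) , map C V1 ++ C t ∷ [])
  label-oldMaximum v V2′ V2≡ one with lowerMaxima-facts v V2′ V2≡
  ... | low≡v , V2′≤v , v≤t , _ , _ = label-shape (suc (suc (C v))) (begin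
      C′ 0
    ≡⟨ C′0-split ⟩
      count a′ 0 (suc t) + C t
    ≡⟨ cong (_+ C t) (count-splitAt a′ 0 v (suc t) z≤n (≤-trans v≤t (n≤1+n t))) ⟩
      (count a′ 0 v + count a′ v (suc t ∸ v)) + C t
    ≡⟨ cong (λ z → (z + count a′ v (suc t ∸ v)) + C t) one ⟩
      suc (count a′ v (suc t ∸ v)) + C t
    ≡⟨ cong (λ z → suc z + C t) (count-low v v≤t (subst (All (_≤ v)) (sym low≡v) (AllP.++⁺ V2′≤v (≤-refl ∷ [])))) ⟩
      suc (count a v (suc t ∸ v)) + C t
    ≡⟨ cong (λ z → suc z + C t) (count-through-t v v≤t) ⟩
      suc ((count a v (t ∸ v) + 1) + C t)
    ≡⟨ cong suc (trans (+-assoc (count a v (t ∸ v)) 1 (C t)) (+-suc (count a v (t ∸ v)) (C t))) ⟩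
      suc (suc (count a v (t ∸ v) + C t))
    ≡⟨ cong (λ z → suc (suc z)) (sym (C-split v v≤t)) ⟩
      suc (suc (C v))
    ∎)
    where open ≡-Reasoning

-- For SS it is v-1: every smaller site s is blocked by the letters v-1 and v.
-- For SrS it is 0: every site s ∈ [1,v) is blocked by the letters 1 and v.
sitesBelow-one : ∀ c π t (π∈C : InC c π) (t≤n : t ≤ length π) (t-active : T (active c π t)) V1 v V2 →
  rlMaxima π ≡ V1 ++ v ∷ V2 → All (t <_) V1 → All (_≤ t) (v ∷ V2) → count (active c (insertAt π t)) 0 v ≡ 1
sitesBelow-one SS π t π∈C t≤n t-active V1 v V2 rl≡ V1>t vV2≤t
  with ChildLabel.lowerMaxima-facts SS π t π∈C t≤n t-active V1 (v ∷ V2) rl≡ V1>t vV2≤t v V2 refl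
... | low≡ , V2≤v , v≤t , v∈F , 1≤v = begin
    count a′ 0 v
  ≡⟨ count-splitAt a′ 0 (v ∸ 1) v z≤n (m∸n≤m v 1) ⟩
    count a′ 0 (v ∸ 1) + count a′ (v ∸ 1) (v ∸ (v ∸ 1))
  ≡⟨ cong₂ _+_ (count-none a′ 0 (v ∸ 1) blocked) (cong (count a′ (v ∸ 1)) (m∸[m∸n]≡n 1≤v)) ⟩
    count a′ (v ∸ 1) 1
  ≡⟨ trans (count-one a′ (v ∸ 1)) (cong indicator (SS-site-active π t π∈C t≤n t-active (reverse V2) v low≡ V2≤v v≤t v∈F 1≤v)) ⟩
    1
  ∎
  where
    open ≡-Reasoning
    open ChildSites SS π t π∈C t≤n t-active
    a′ = active SS π′
    v-1<v : v ∸ 1 < v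
    v-1<v = ≤-reflexive (m+[n∸m]≡n 1≤v)
    blocked : OnInterval (λ s → a′ s ≡ false) 0 (v ∸ 1)
    blocked s _ s<v-1 = blocked-site (reverse V2) v s (v ∸ 1) low≡ (≤-trans (m∸n≤m v 1) v≤t)
      (≤-trans (s≤s z≤n) s<v-1) (<⇒≢ v-1<v) (s<v-1 , v-1<v)
sitesBelow-one SrS π t π∈C t≤n t-active V1 v V2 rl≡ V1>t vV2≤t
  with ChildLabel.lowerMaxima-facts SrS π t π∈C t≤n t-active V1 (v ∷ V2) rl≡ V1>t vV2≤t v V2 refl
... | low≡ , _ , v≤t , _ , 1≤v = begin
    count a′ 0 v
  ≡⟨ count-splitAt a′ 0 1 v z≤n 1≤v ⟩
    count a′ 0 1 + count a′ 1 (v ∸ 1)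
  ≡⟨ cong₂ _+_ (trans (count-one a′ 0) (cong indicator (SrS-site0-active π t π∈C t≤n t-active))) (count-none a′ 1 (v ∸ 1) blocked) ⟩
    1
  ∎
  where
    open ≡-Reasoning
    open ChildSites SrS π t π∈C t≤n t-active
    a′ = active SrS π′
    blocked : OnInterval (λ s → a′ s ≡ false) 1 (v ∸ 1)
    blocked s 1≤s s<v = blocked-site (reverse V2) v s 1 low≡ (≤-trans 1≤s (≤-trans (<⇒≤ s<v′) v≤t)) ≤-refl
      (<⇒≢ (≤-trans (s≤s 1≤s) s<v′)) (1≤s , s<v′)
      where
        s<v′ : s < v
        s<v′ = ≤-trans s<v (≤-reflexive (m+[n∸m]≡n 1≤v))

label-child-top : ∀ c π t → InC c π → t ≤ length π → T (active c π t) → All (t <_) (rlMaxima π) →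
  let C = countFrom (active c π) (suc (length π)) in
  label c (insertAt π t) ≡ (suc (C 0) , suc (length (rlMaxima π)) , map C (rlMaxima π) ++ C t ∷ [])
label-child-top c π t π∈C t≤n t-active V>t =
  ChildLabel.label-newMaximum c π t π∈C t≤n t-active (rlMaxima π) [] (sym (++-identityʳ _)) V>t [] refl

label-child-below : ∀ c π t → InC c π → t ≤ length π → T (active c π t) → ∀ V1 v V2 →
  rlMaxima π ≡ V1 ++ v ∷ V2 → All (t <_) V1 → All (_≤ t) (v ∷ V2) →
  let C = countFrom (active c π) (suc (length π)) in
  label c (insertAt π t) ≡ (suc (suc (C v)) , suc (length V1) , map C V1 ++ C t ∷ [])
label-child-below c π t π∈C t≤n t-active V1 v V2 rl≡ V1>t vV2≤t =
  ChildLabel.label-oldMaximum c π t π∈C t≤n t-active V1 (v ∷ V2) rl≡ V1>t vV2≤t v V2 refl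
    (sitesBelow-one c π t π∈C t≤n t-active V1 v V2 rl≡ V1>t vV2≤t)

-- Listed downwards, the active sites of π are
-- grouped by the right-to-left maxima v_1 > … > v_k: the j-th group consists of
-- the active sites in [v_j, v_{j-1}) (v_0 = n+1), the last group of those below
-- v_k.  Along a group the labels follow the values p(s), which run exactly
-- through the interval (p_j, p_{j-1}] of `expectedChildren`.

activeDown : (ℕ → Bool) → ℕ → ℕ → List ℕ
activeDown a lo zero = []
activeDown a lo (suc d) = activeDown a (suc lo) d ++ (if a lo then lo ∷ [] else [])

reverse-select-interval : ∀ a lo d → reverse (select a (applyUpTo (lo +_) d)) ≡ activeDown a lo d
reverse-select-interval a lo zero = refl
reverse-select-interval a lo (suc d) rewrite +-identityʳ lo
  | applyUpTo-cong (λ x → lo + suc x) (λ x → suc lo + x) d (λ x → +-suc lo x) with a lo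
... | true = trans (unfold-reverse lo (select a (applyUpTo (suc lo +_) d))) (cong (_++ lo ∷ []) (reverse-select-interval a (suc lo) d))
... | false = trans (reverse-select-interval a (suc lo) d) (sym (++-identityʳ _))

activeDown-split : ∀ a lo d1 d2 → activeDown a lo (d1 + d2) ≡ activeDown a (lo + d1) d2 ++ activeDown a lo d1
activeDown-split a lo zero d2 = trans (cong (λ z → activeDown a z d2) (sym (+-identityʳ lo))) (sym (++-identityʳ _))
activeDown-split a lo (suc d1) d2 =
  trans (cong (_++ _) (trans (activeDown-split a (suc lo) d1 d2) (cong (λ z → activeDown a z d2 ++ activeDown a (suc lo) d1) (sym (+-suc lo d1)))))
        (++-assoc (activeDown a (lo + suc d1) d2) _ _)

activeDown-All : ∀ a lo d → All (λ s → lo ≤ s × s < lo + d × a s ≡ true) (activeDown a lo d)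
activeDown-All a lo zero = []
activeDown-All a lo (suc d) =
  AllP.++⁺ (AllM.map (λ { (p , q , r) → ≤-trans (n≤1+n lo) p , ≤-trans q (≤-reflexive (sym (+-suc lo d))) , r }) (activeDown-All a (suc lo) d)) last
  where
    last : All (λ s → lo ≤ s × s < lo + suc d × a s ≡ true) (if a lo then lo ∷ [] else [])
    last with a lo in e
    ... | true = (≤-refl , m<m+n lo z<s , e) ∷ []
    ... | false = []

range-empty : ∀ A → range A A ≡ []
range-empty A rewrite n∸n≡0 A = refl

range-∷ʳ : ∀ A B → A ≤ B → range A B ++ suc B ∷ [] ≡ range A (suc B)
range-∷ʳ A B ab =
  trans (cong (range A B ++_) (cong (_∷ []) (sym (trans (+-suc A (B ∸ A)) (cong suc (m+[n∸m]≡n ab))))))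
    (trans (sym (map-++ (λ d → A + suc d) (upTo (B ∸ A)) (B ∸ A ∷ [])))
      (cong (map (λ d → A + suc d)) (trans (upTo-∷ʳ (B ∸ A)) (cong upTo (sym (+-∸-assoc 1 ab))))))

module CountsAbove (a : ℕ → Bool) (M : ℕ) where
  C : ℕ → ℕ
  C = countFrom a M

  C-M : C M ≡ 0
  C-M rewrite n∸n≡0 M = refl

  C-antitone : ∀ w u → w ≤ u → u ≤ M → C u ≤ C w
  C-antitone w u w≤u u≤M = ≤-trans (m≤n+m (C u) (count a w (u ∸ w))) (≤-reflexive (sym (count-splitAt a w u M w≤u u≤M)))

  C-step : ∀ lo → lo < M → C lo ≡ indicator (a lo) + C (suc lo)
  C-step lo lo<M = cong (count a lo) (∸-suc M lo lo<M)
    where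
      ∸-suc : ∀ M lo → lo < M → M ∸ lo ≡ suc (M ∸ suc lo)
      ∸-suc (suc M) zero _ = refl
      ∸-suc (suc M) (suc lo) (s≤s p) = ∸-suc M lo p

  map-C-activeDown : ∀ lo d → lo + d ≤ M → map C (activeDown a lo d) ≡ range (C (lo + d)) (C lo)
  map-C-activeDown lo zero _ rewrite +-identityʳ lo = sym (range-empty (C lo))
  map-C-activeDown lo (suc d) hi≤M = begin
      map C (activeDown a (suc lo) d ++ (if a lo then lo ∷ [] else []))
    ≡⟨ map-++ C (activeDown a (suc lo) d) _ ⟩
      map C (activeDown a (suc lo) d) ++ map C (if a lo then lo ∷ [] else [])
    ≡⟨ cong (_++ map C (if a lo then lo ∷ [] else [])) below ⟩
      range (C (lo + suc d)) (C (suc lo)) ++ map C (if a lo then lo ∷ [] else [])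
    ≡⟨ last (C-step lo (<-≤-trans (m<m+n lo z<s) hi≤M)) ⟩
      range (C (lo + suc d)) (C lo)
    ∎
    where
      open ≡-Reasoning
      below : map C (activeDown a (suc lo) d) ≡ range (C (lo + suc d)) (C (suc lo))
      below = trans (map-C-activeDown (suc lo) d (≤-trans (≤-reflexive (sym (+-suc lo d))) hi≤M))
                    (cong (λ z → range (C z) (C (suc lo))) (sym (+-suc lo d)))
      ordered : C (lo + suc d) ≤ C (suc lo)
      ordered = C-antitone (suc lo) (lo + suc d) (≤-trans (s≤s (m≤m+n lo d)) (≤-reflexive (sym (+-suc lo d)))) hi≤M
      last : C lo ≡ indicator (a lo) + C (suc lo) →
             range (C (lo + suc d)) (C (suc lo)) ++ map C (if a lo then lo ∷ [] else []) ≡ range (C (lo + suc d)) (C lo)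
      last e with a lo
      ... | true rewrite e = range-∷ʳ _ _ ordered
      ... | false rewrite e = ++-identityʳ _

increasing-reverse⇒decreasing : ∀ V → Increasing (reverse V) → Decreasing V
increasing-reverse⇒decreasing [] _ = tt
increasing-reverse⇒decreasing (v ∷ V) s with Increasing-++⁻ (reverse V) (v ∷ []) (subst Increasing (unfold-reverse v V) s)
... | sV , _ , cr = PermP.All-resp-↭ (PermP.↭-reverse V) (AllM.map (λ { (p ∷ []) → p }) cr) , increasing-reverse⇒decreasing V sV

-- `rlAt M V j` is v_j, the j-th entry of V (1-indexed), with v_0 = M.
rlAt : ℕ → List ℕ → ℕ → ℕ
rlAt M V zero = M
rlAt M [] (suc j) = 0
rlAt M (v ∷ V) (suc zero) = v
rlAt M (v ∷ V) (suc (suc j)) = rlAt M V (suc j)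

pAt-map : ∀ (C : ℕ → ℕ) M → C M ≡ 0 → ∀ V j → j ≤ length V → pAt (map C V) j ≡ C (rlAt M V j)
pAt-map C M e V zero _ = sym e
pAt-map C M e (v ∷ V) (suc zero) _ = refl
pAt-map C M e (v ∷ V) (suc (suc j)) (s≤s p) = pAt-map C M e V (suc j) p

rlAt-All : ∀ {P : ℕ → Set} M V j → All P V → j < length V → P (rlAt M V (suc j))
rlAt-All M (v ∷ V) zero (p ∷ _) _ = p
rlAt-All M (v ∷ V) (suc j) (_ ∷ ps) (s≤s q) = rlAt-All M V j ps q

rlAt-< : ∀ M V → All (_< M) V → Decreasing V → ∀ j → j < length V → rlAt M V (suc j) < rlAt M V j
rlAt-< M (v ∷ V) (p ∷ _) _ zero _ = p
rlAt-< M (v ∷ V) _ (a , _) (suc zero) (s≤s q) = rlAt-All M V 0 a q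
rlAt-< M (v ∷ V) (_ ∷ ps) (_ , sd) (suc (suc j)) (s≤s q) = rlAt-< M V ps sd (suc j) q

rlAt-≤ : ∀ M V → All (_< M) V → ∀ j → j ≤ length V → rlAt M V j ≤ M
rlAt-≤ M V _ zero _ = ≤-refl
rlAt-≤ M (v ∷ V) (p ∷ _) (suc zero) _ = <⇒≤ p
rlAt-≤ M (v ∷ V) (_ ∷ ps) (suc (suc j)) (s≤s q) = rlAt-≤ M V ps (suc j) q

drop-rlAt : ∀ M V j → j < length V → drop j V ≡ rlAt M V (suc j) ∷ drop (suc j) V
drop-rlAt M (v ∷ V) zero _ = refl
drop-rlAt M (v ∷ V) (suc j) (s≤s q) = drop-rlAt M V j q

take-above : ∀ M V → Decreasing V → ∀ j → j ≤ length V → ∀ s → s < rlAt M V j → All (s <_) (take j V)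
take-above M V _ zero _ s _ = []
take-above M (v ∷ V) (a , sd) (suc zero) _ s p = p ∷ []
take-above M (v ∷ V) (a , sd) (suc (suc j)) (s≤s q) s p =
  <-trans p (rlAt-All M V j a q) ∷ take-above M V sd (suc j) q s p

drop-below : ∀ M V → Decreasing V → ∀ j → j < length V → ∀ s → rlAt M V (suc j) ≤ s → All (_≤ s) (drop j V)
drop-below M (v ∷ V) (a , sd) zero _ s p = p ∷ AllM.map (λ q → ≤-trans (<⇒≤ q) p) a
drop-below M (v ∷ V) (a , sd) (suc j) (s≤s q) s p = drop-below M V sd j q s p

module ChildLabels (c : Class) (π : List ℕ) (π∈C : InC c π) where
  n = length π
  M = suc n
  a = active c π
  open CountsAbove a M
  V = rlMaxima π
  k = length V
  ps = map C V
  x = count a 0 M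
  childLabel : ℕ → Label
  childLabel s = label c (insertAt π s)

  factsπ = memberFacts c π π∈C
  V↓ : Decreasing V
  V↓ = increasing-reverse⇒decreasing V (subst Increasing (proj₂ (proj₂ (proj₂ factsπ))) (proj₁ (proj₂ (proj₂ factsπ))))
  V<M : All (_< M) V
  V<M = AllM.map (λ { (_ , q) → s≤s q }) (rlMaxima-All π (proj₁ (proj₁ factsπ)))

  v : ℕ → ℕ
  v = rlAt M V

  G : ℕ → List Label
  G j = map (λ i → (2 + pAt ps j , j , take (j ∸ 1) ps ++ i ∷ [])) (range (pAt ps (j ∸ 1)) (pAt ps j))

  group-labels : ∀ j → j < k → map childLabel (activeDown a (v (suc j)) (v j ∸ v (suc j))) ≡ G (suc j)
  group-labels j j<k = begin
      map childLabel D
    ≡⟨ map-cong-local (AllM.map (λ { {s} (v′≤s , s<hi , s-active) → label-s s v′≤s (≤-trans s<hi (≤-reflexive (m+[n∸m]≡n v′≤v))) s-active })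
                                (activeDown-All a v′ (v j ∸ v′))) ⟩
      map (λ s → g (C s)) D
    ≡⟨ map-∘ D ⟩
      map g (map C D)
    ≡⟨ cong (map g) (trans (map-C-activeDown v′ (v j ∸ v′) (≤-trans (≤-reflexive (m+[n∸m]≡n v′≤v)) (rlAt-≤ M V V<M j (<⇒≤ j<k))))
                           (cong (λ z → range (C z) (C v′)) (m+[n∸m]≡n v′≤v))) ⟩
      map g (range (C (v j)) (C v′))
    ≡⟨ cong₂ (λ p q → map (λ i → (2 + q , suc j , take j ps ++ i ∷ [])) (range p q))
             (sym (pAt-map C M C-M V j (<⇒≤ j<k))) (sym (pAt-map C M C-M V (suc j) j<k)) ⟩
      G (suc j)
    ∎
    where
      open ≡-Reasoning
      v′ = v (suc j)
      D = activeDown a v′ (v j ∸ v′)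
      v′≤v : v′ ≤ v j
      v′≤v = <⇒≤ (rlAt-< M V V<M V↓ j j<k)
      g : ℕ → Label
      g i = (2 + C v′ , suc j , take j ps ++ i ∷ [])
      label-s : ∀ s → v′ ≤ s → s < v j → a s ≡ true → childLabel s ≡ g (C s)
      label-s s v′≤s s<v s-active = trans
        (label-child-below c π s π∈C (≤-pred (≤-trans s<v (rlAt-≤ M V V<M j (<⇒≤ j<k)))) (subst T (sym s-active) tt)
           (take j V) v′ (drop (suc j) V) (trans (sym (take++drop≡id j V)) (cong (take j V ++_) (drop-rlAt M V j j<k)))
           (take-above M V V↓ j (<⇒≤ j<k) s s<v) (subst (All (_≤ s)) (drop-rlAt M V j j<k) (drop-below M V V↓ j j<k s v′≤s)))
        (Label-≡ refl (cong suc (trans (length-take j V) (m≤n⇒m⊓n≡m (<⇒≤ j<k)))) (cong (_++ C s ∷ []) (sym (take-map j V))))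

  oldMaxima-labels : ∀ j → j ≤ k → concatMap G (map suc (upTo j)) ≡ map childLabel (activeDown a (v j) (M ∸ v j))
  oldMaxima-labels zero _ rewrite n∸n≡0 M = refl
  oldMaxima-labels (suc j) j<k = begin
      concatMap G (map suc (upTo (suc j)))
    ≡⟨ cong (λ z → concatMap G (map suc z)) (sym (upTo-∷ʳ j)) ⟩
      concatMap G (map suc (upTo j ++ j ∷ []))
    ≡⟨ cong (concatMap G) (map-++ suc (upTo j) (j ∷ [])) ⟩
      concatMap G (map suc (upTo j) ++ suc j ∷ [])
    ≡⟨ concatMap-++ G (map suc (upTo j)) (suc j ∷ []) ⟩
      concatMap G (map suc (upTo j)) ++ (G (suc j) ++ [])
    ≡⟨ cong₂ _++_ (oldMaxima-labels j (<⇒≤ j<k)) (trans (++-identityʳ _) (sym (group-labels j j<k))) ⟩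
      map childLabel (activeDown a (v j) (M ∸ v j)) ++ map childLabel (activeDown a v′ (v j ∸ v′))
    ≡⟨ sym (map-++ childLabel (activeDown a (v j) (M ∸ v j)) _) ⟩
      map childLabel (activeDown a (v j) (M ∸ v j) ++ activeDown a v′ (v j ∸ v′))
    ≡⟨ cong (map childLabel) (sym (trans (cong (activeDown a v′) (sym lengths))
         (trans (activeDown-split a v′ (v j ∸ v′) (M ∸ v j))
           (cong (λ z → activeDown a z (M ∸ v j) ++ activeDown a v′ (v j ∸ v′)) (m+[n∸m]≡n v′≤v))))) ⟩
      map childLabel (activeDown a v′ (M ∸ v′))
    ∎
    where
      open ≡-Reasoning
      v′ = v (suc j)
      v′≤v : v′ ≤ v j
      v′≤v = <⇒≤ (rlAt-< M V V<M V↓ j j<k)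
      lengths : (v j ∸ v′) + (M ∸ v j) ≡ M ∸ v′
      lengths = trans (sym (+-∸-comm (M ∸ v j) v′≤v)) (cong (_∸ v′) (trans (+-comm (v j) (M ∸ v j)) (m∸n+n≡m (rlAt-≤ M V V<M j (<⇒≤ j<k)))))

  newMaximum-labels : map childLabel (activeDown a 0 (v k)) ≡ map (λ i → (suc x , suc k , ps ++ i ∷ [])) (range (pAt ps k) x)
  newMaximum-labels = begin
      map childLabel D
    ≡⟨ map-cong-local (AllM.map (λ { {s} (_ , s<v , s-active) → label-s s s<v s-active }) (activeDown-All a 0 (v k))) ⟩
      map (λ s → g (C s)) D
    ≡⟨ map-∘ D ⟩
      map g (map C D)
    ≡⟨ cong (map g) (map-C-activeDown 0 (v k) (rlAt-≤ M V V<M k ≤-refl)) ⟩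
      map g (range (C (v k)) (C 0))
    ≡⟨ cong (λ z → map g (range z (C 0))) (sym (pAt-map C M C-M V k ≤-refl)) ⟩
      map g (range (pAt ps k) x)
    ∎
    where
      open ≡-Reasoning
      D = activeDown a 0 (v k)
      g : ℕ → Label
      g i = (suc x , suc k , ps ++ i ∷ [])
      label-s : ∀ s → s < v k → a s ≡ true → childLabel s ≡ g (C s)
      label-s s s<v s-active = label-child-top c π s π∈C (≤-pred (≤-trans s<v (rlAt-≤ M V V<M k ≤-refl))) (subst T (sym s-active) tt)
        (subst (All (s <_)) (take-all k V ≤-refl) (take-above M V V↓ k ≤-refl s s<v))

  reverse-childLabels : reverse (childLabels c π) ≡ expectedChildren (x , k , ps)
  reverse-childLabels = begin
      reverse (map childLabel (activeSites c π))
    ≡⟨ sym (reverse-map childLabel (activeSites c π)) ⟩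
      map childLabel (reverse (filterᵇ a (upTo M)))
    ≡⟨ cong (λ z → map childLabel (reverse z)) (filterᵇ≡select a (upTo M)) ⟩
      map childLabel (reverse (select a (applyUpTo (0 +_) M)))
    ≡⟨ cong (map childLabel) (reverse-select-interval a 0 M) ⟩
      map childLabel (activeDown a 0 M)
    ≡⟨ cong (map childLabel) (trans (cong (activeDown a 0) (sym (m+[n∸m]≡n (rlAt-≤ M V V<M k ≤-refl)))) (activeDown-split a 0 (v k) (M ∸ v k))) ⟩
      map childLabel (activeDown a (v k) (M ∸ v k) ++ activeDown a 0 (v k))
    ≡⟨ map-++ childLabel (activeDown a (v k) (M ∸ v k)) _ ⟩
      map childLabel (activeDown a (v k) (M ∸ v k)) ++ map childLabel (activeDown a 0 (v k))
    ≡⟨ cong₂ _++_ (sym (oldMaxima-labels k ≤-refl)) newMaximum-labels ⟩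
      expectedChildren (x , k , ps)
    ∎
    where open ≡-Reasoning

childLabels↭ : ∀ c π → InC c π → childLabels c π ↭ expectedChildren (label c π)
childLabels↭ c π π∈C = ↭-trans (↭-sym (PermP.↭-reverse (childLabels c π)))
  (↭-reflexive (trans (ChildLabels.reverse-childLabels c π π∈C) (cong expectedChildren (sym (label≡counts c π)))))

-- The root 1 has the two active sites 0 and 1 and the single maximum 1.
label-one : ∀ c → label c (1 ∷ []) ≡ (2 , 1 , 1 ∷ [])
label-one SS = refl
label-one SrS = refl

theorem3p2 : (c : Class) →
    ((π : List ℕ) → InC c π → 2 ≤ length π → InC c (deleteLast π))
    × label c (1 ∷ []) ≡ (2 , 1 , 1 ∷ [])
    × ((π : List ℕ) → InC c π → childLabels c π ↭ expectedChildren (label c π))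
theorem3p2 c = deleteLast-closed c , label-one c , childLabels↭ c
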